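{- Let $\alpha$ be an FLIF expression, let $W$ be a set of variables, and let $\rho$ be a bijection from $O(\alpha)$ onto a set of variables disjoint from $\mathrm{vars}(\alpha)$. Then there exists an io-disjoint FLIF expression $\beta$ such that (1) $I(\beta)=I(\alpha)$; (2) $O(\beta)\supseteq\rho(O(\alpha))$ and $O(\beta)\setminus\rho(O(\alpha))$ is disjoint from $W$; and (3) for every instance $D$ and every valuation $\nu_1$, \[\{\nu_2|_{O(\alpha)}\mid(\nu_1,\nu_2)\in[\![\alpha]\!]_D\}=\{\nu_2\circ\rho\mid(\nu_1,\nu_2)\in[\![\beta]\!]_D\}.\]
   Context: Fix a countably infinite set $\mathbf{dom}$ of constants and the set $\mathcal U$ of all variables. A schema $\mathcal S$ is a finite set of relation names $R$ with arity $\mathrm{ar}(R)$ and input arity $\mathrm{iar}(R)\le\mathrm{ar}(R)$; $\mathrm{oar}(R)=\mathrm{ar}(R)-\mathrm{iar}(R)$. An instance $D$ assigns each $R$ a relation $D(R)\subseteq\mathbf{dom}^{\mathrm{ar}(R)}$. Valuations are maps $\mathcal U\to\mathbf{dom}$; $\nu(c)=c$ for constants; $\nu[x:=c]$ is $\nu$ changed at $x$. FLIF expressions: atomic $R(\bar x;\bar y)$ ($\bar x$ of length $\mathrm{iar}(R)$, $\bar y$ of length $\mathrm{oar}(R)$), $(x=y)$, $(x=c)$, $(x:=y)$, $(x:=c)$; closed under $;$, $\cup$, $-$. $\mathrm{vars}(\alpha)$ is the set of variables occurring in $\alpha$. Semantics $[\![\alpha]\!]_D$ (pairs of valuations): $R(\bar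 x;\bar y)$: $(\nu_1,\nu_2)$ with $\nu_1(\bar x)\cdot\nu_2(\bar y)\in D(R)$ and $\nu_1,\nu_2$ agreeing outside the variables of $\bar y$; $(x=y)$: $(\nu,\nu)$ with $\nu(x)=\nu(y)$; $(x=c)$: $(\nu,\nu)$ with $\nu(x)=c$; $(x:=y)$: $(\nu,\nu[x:=\nu(y)])$; $(x:=c)$: $(\nu,\nu[x:=c])$; $;$ is relational composition, $\cup,-$ union and difference. Input/output variables: $I(R(\bar x;\bar y))=X$, $O=Y$ (variables of $\bar x$, $\bar y$); $I(x=y)=\{x,y\}$, $O=\emptyset$; $I(x:=y)=\{y\}$, $O=\{x\}$; $I(x=c)=\{x\}$, $O=\emptyset$; $I(x:=c)=\emptyset$, $O=\{x\}$; $I(\alpha_1;\alpha_2)=I(\alpha_1)\cup(I(\alpha_2)\setminus O(\alpha_1))$, $O=O(\alpha_1)\cup O(\alpha_2)$; $I(\alpha_1\cup\alpha_2)=I(\alpha_1)\cup I(\alpha_2)\cup(O(\alpha_1)\triangle O(\alpha_2))$, $O=O(\alpha_1)\cup O(\alpha_2)$; $I(\alpha_1-\alpha_2)=I(\alpha_1)\cup I(\alpha_2)\cup(O(\alpha_1)\triangle O(\alpha_2))$, $O=O(\alpha_1)$. An expression is io-disjoint if $I(\beta)\cap O(\beta)=\emptyset$ for every subexpression $\beta$ (including itself). $\nu_2\circ\rho$ is the map $x\mapsto\nu_2(\rho(x))$ on $O(\alpha)$. -}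

module Defs where

open import Data.Nat using (ℕ; _≡ᵇ_)
open import Data.Fin using (Fin)
open import Data.Bool using (Bool; true; false; _∨_; _∧_; not; if_then_else_)
open import Data.Vec using (Vec; []; _∷_; map; _++_)
open import Data.Product using (Σ; ∃; _×_; _,_)
open import Data.Sum using (_⊎_)
open import Relation.Nullary using (¬_)
open import Relation.Binary.PropositionalEquality using (_≡_)

Var : Set
Var = ℕ

Dom : Set
Dom = ℕ

-- A schema: a finite set of relation names (Fin size) with input and
-- output arity; ar R = iar R + oar R.
record Schema : Set where
  field
    size : ℕ
    iar  : Fin size → ℕ
    oar  : Fin size → ℕ

open Schema public

Rel : Schema → Set
Rel S = Fin (size S)

-- An instance assigns to every relation name R a relation D(R) ⊆ dom^{ar R},
-- tuples being written as (input part) ++ (output part).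
Instance : Schema → Set₁
Instance S = (R : Rel S) → Vec Dom (iar S R) → Vec Dom (oar S R) → Set

Valuation : Set
Valuation = Var → Dom

_[_≔_] : Valuation → Var → Dom → Valuation
(ν [ x ≔ c ]) z = if z ≡ᵇ x then c else ν z

_≐_ : Valuation → Valuation → Set
ν ≐ μ = ∀ z → ν z ≡ μ z

data Expr (S : Schema) : Set where
  atom   : (R : Rel S) → Vec Var (iar S R) → Vec Var (oar S R) → Expr S
  eqv    : Var → Var → Expr S
  eqc    : Var → Dom → Expr S
  asgv   : Var → Var → Expr S
  asgc   : Var → Dom → Expr S
  _⨾_    : Expr S → Expr S → Expr S
  _∪ₑ_   : Expr S → Expr S → Expr S
  _−ₑ_   : Expr S → Expr S → Expr S

memᵇ : ∀ {n} → Var → Vec Var n → Bool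
memᵇ x []       = false
memᵇ x (y ∷ ys) = (x ≡ᵇ y) ∨ memᵇ x ys

xorᵇ : Bool → Bool → Bool
xorᵇ a b = (a ∧ not b) ∨ (b ∧ not a)

vars : ∀ {S} → Expr S → Var → Bool
vars (atom R xs ys) z = memᵇ z xs ∨ memᵇ z ys
vars (eqv x y)  z = (z ≡ᵇ x) ∨ (z ≡ᵇ y)
vars (eqc x c)  z = z ≡ᵇ x
vars (asgv x y) z = (z ≡ᵇ x) ∨ (z ≡ᵇ y)
vars (asgc x c) z = z ≡ᵇ x
vars (a ⨾ b)    z = vars a z ∨ vars b z
vars (a ∪ₑ b)   z = vars a z ∨ vars b z
vars (a −ₑ b)   z = vars a z ∨ vars b z

I O : ∀ {S} → Expr S → Var → Bool
I (atom R xs ys) z = memᵇ z xs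
I (eqv x y)  z = (z ≡ᵇ x) ∨ (z ≡ᵇ y)
I (eqc x c)  z = z ≡ᵇ x
I (asgv x y) z = z ≡ᵇ y
I (asgc x c) z = false
I (a ⨾ b)    z = I a z ∨ (I b z ∧ not (O a z))
I (a ∪ₑ b)   z = I a z ∨ I b z ∨ xorᵇ (O a z) (O b z)
I (a −ₑ b)   z = I a z ∨ I b z ∨ xorᵇ (O a z) (O b z)
O (atom R xs ys) z = memᵇ z ys
O (eqv x y)  z = false
O (eqc x c)  z = false
O (asgv x y) z = z ≡ᵇ x
O (asgc x c) z = z ≡ᵇ x
O (a ⨾ b)    z = O a z ∨ O b z
O (a ∪ₑ b)   z = O a z ∨ O b z
O (a −ₑ b)   z = O a z

IODisjNode : ∀ {S} → Expr S → Set
IODisjNode β = ∀ z → I β z ≡ true → O β z ≡ false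

IODisjoint : ∀ {S} → Expr S → Set
IODisjoint e@(a ⨾ b)  = IODisjNode e × IODisjoint a × IODisjoint b
IODisjoint e@(a ∪ₑ b) = IODisjNode e × IODisjoint a × IODisjoint b
IODisjoint e@(a −ₑ b) = IODisjNode e × IODisjoint a × IODisjoint b
IODisjoint e          = IODisjNode e

⟦_⟧ : ∀ {S} → Expr S → Instance S → Valuation → Valuation → Set
⟦ atom R xs ys ⟧ D ν₁ ν₂ =
  D R (map ν₁ xs) (map ν₂ ys) × (∀ z → memᵇ z ys ≡ false → ν₁ z ≡ ν₂ z)
⟦ eqv x y ⟧  D ν₁ ν₂ = ν₁ ≐ ν₂ × ν₁ x ≡ ν₁ y
⟦ eqc x c ⟧  D ν₁ ν₂ = ν₁ ≐ ν₂ × ν₁ x ≡ c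
⟦ asgv x y ⟧ D ν₁ ν₂ = (ν₁ [ x ≔ ν₁ y ]) ≐ ν₂
⟦ asgc x c ⟧ D ν₁ ν₂ = (ν₁ [ x ≔ c ]) ≐ ν₂
⟦ a ⨾ b ⟧    D ν₁ ν₂ = ∃ λ ν → ⟦ a ⟧ D ν₁ ν × ⟦ b ⟧ D ν ν₂
⟦ a ∪ₑ b ⟧   D ν₁ ν₂ = ⟦ a ⟧ D ν₁ ν₂ ⊎ ⟦ b ⟧ D ν₁ ν₂
⟦ a −ₑ b ⟧   D ν₁ ν₂ = ⟦ a ⟧ D ν₁ ν₂ × ¬ ⟦ b ⟧ D ν₁ ν₂

-- ρ is a bijection from O(α) onto a set of variables disjoint from vars(α)
-- (ρ is a total function on variables; only its restriction to O(α) matters).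
RenamingFor : ∀ {S} → Expr S → (Var → Var) → Set
RenamingFor α ρ =
  (∀ x y → O α x ≡ true → O α y ≡ true → ρ x ≡ ρ y → x ≡ y)
  × (∀ x → O α x ≡ true → vars α (ρ x) ≡ false)

InImage : ∀ {S} → Expr S → (Var → Var) → Var → Set
InImage α ρ y = ∃ λ x → O α x ≡ true × ρ x ≡ y

{-# OPTIONS --safe #-}
module Submission where

-- The expression β is built by structural recursion on α, carrying an input
-- renaming σ (initially the identity), the output renaming ρ and a bound n
-- above every variable in play; auxiliary variables are taken from [n, ∞),
-- which is how O(β) avoids W.  Atoms and assignments are renamed.  In α₁ ; α₂
-- the outputs of α₁ that α₂ overwrites are sent to fresh variables n + x, and α₂
-- reads α₁'s outputs through their new names.  The two branches of a union are
-- given the same outputs: each copies σ x to ρ x for every output x produced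
-- only by the other branch, and sets every auxiliary output of either branch to
-- 0.  For α₁ − α₂, the translation of α₂ writes its outputs to fresh
-- variables n + x, which are then tested against the current values of the
-- corresponding variables of α₁ ; this selects exactly the pairs of α₁ that are
-- also pairs of α₂.  An invariant on (σ, ρ, n) keeps inputs, outputs and
-- auxiliary variables apart, which gives io-disjointness at every node.

open import Defs
open import Data.Bool using (Bool; true; false; _∨_; _∧_; not; if_then_else_)
open import Data.Bool.Properties using (∨-assoc; ∨-comm; ∨-identityʳ; T-≡)
open import Data.Empty using (⊥; ⊥-elim)
open import Data.List as L using (List; []; _∷_; _++_; filterᵇ)
open import Data.List.Membership.Propositional using (_∈_)
open import Data.List.Relation.Unary.Any using (here; there)
open import Data.Nat using (ℕ; zero; suc; _+_; _≤_; _<_; _≡ᵇ_; _≤ᵇ_)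
open import Data.Nat.Properties
open import Data.Product using (∃; _×_; _,_; proj₁; proj₂)
open import Data.Sum using (_⊎_; inj₁; inj₂; [_,_])
open import Data.Unit using (⊤; tt)
open import Data.Vec as V using (Vec; []; _∷_)
open import Data.Vec.Properties using (map-∘; map-cong)
open import Function using (_∘_)
open import Function.Bundles using (Equivalence)
open import Relation.Nullary using (¬_)
open import Relation.Binary.PropositionalEquality hiding ([_])

∨-true⁻ : ∀ a b → a ∨ b ≡ true → a ≡ true ⊎ b ≡ true
∨-true⁻ true  b _ = inj₁ refl
∨-true⁻ false b p = inj₂ p

∨-trueˡ : ∀ {a} b → a ≡ true → a ∨ b ≡ true
∨-trueˡ b refl = refl

∨-trueʳ : ∀ a {b} → b ≡ true → a ∨ b ≡ true
∨-trueʳ true  _ = refl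
∨-trueʳ false p = p

∨-false : ∀ {a b} → a ≡ false → b ≡ false → a ∨ b ≡ false
∨-false refl refl = refl

∨-falseˡ⁻ : ∀ a b → a ∨ b ≡ false → a ≡ false
∨-falseˡ⁻ false b _ = refl

∨-falseʳ⁻ : ∀ a b → a ∨ b ≡ false → b ≡ false
∨-falseʳ⁻ false b p = p

∧-true⁻ : ∀ a b → a ∧ b ≡ true → a ≡ true × b ≡ true
∧-true⁻ true true _ = refl , refl

∧-true : ∀ {a b} → a ≡ true → b ≡ true → a ∧ b ≡ true
∧-true refl refl = refl

not-true⁻ : ∀ a → not a ≡ true → a ≡ false
not-true⁻ false _ = refl

not-true : ∀ {a} → a ≡ false → not a ≡ true
not-true refl = refl

true≢false : ∀ {a} → a ≡ true → a ≡ false → ⊥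
true≢false refl ()

¬true⇒false : ∀ {a} → ¬ a ≡ true → a ≡ false
¬true⇒false {true}  h = ⊥-elim (h refl)
¬true⇒false {false} h = refl

⇔true⇒≡ : ∀ {a b} → (a ≡ true → b ≡ true) → (b ≡ true → a ≡ true) → a ≡ b
⇔true⇒≡ {true}  {true}  f g = refl
⇔true⇒≡ {true}  {false} f g = sym (f refl)
⇔true⇒≡ {false} {true}  f g = g refl
⇔true⇒≡ {false} {false} f g = refl

bool-cases : ∀ b → b ≡ true ⊎ b ≡ false
bool-cases true  = inj₁ refl
bool-cases false = inj₂ refl

xor-true⁻ : ∀ a b → xorᵇ a b ≡ true → (a ≡ true × b ≡ false) ⊎ (a ≡ false × b ≡ true)
xor-true⁻ true  false _ = inj₁ (refl , refl)
xor-true⁻ false true  _ = inj₂ (refl , refl)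

xor-≡⇒false : ∀ {a b} → a ≡ b → xorᵇ a b ≡ false
xor-≡⇒false {true}  refl = refl
xor-≡⇒false {false} refl = refl

xor-trueˡ : ∀ {a b} → a ≡ true → b ≡ false → xorᵇ a b ≡ true
xor-trueˡ refl refl = refl

xor-trueʳ : ∀ {a b} → a ≡ false → b ≡ true → xorᵇ a b ≡ true
xor-trueʳ refl refl = refl

∨-∨-xor-swap : ∀ p q r s → (p ∨ q ∨ xorᵇ r s) ≡ (q ∨ p ∨ xorᵇ s r)
∨-∨-xor-swap true  true  r     s     = refl
∨-∨-xor-swap true  false r     s     = refl
∨-∨-xor-swap false true  r     s     = refl
∨-∨-xor-swap false false true  true  = refl
∨-∨-xor-swap false false true  false = refl
∨-∨-xor-swap false false false true  = refl
∨-∨-xor-swap false false false false = refl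

if-true : ∀ {A : Set} {b} {x y : A} → b ≡ true → (if b then x else y) ≡ x
if-true refl = refl

if-false : ∀ {A : Set} {b} {x y : A} → b ≡ false → (if b then x else y) ≡ y
if-false refl = refl

if-cases : ∀ {A : Set} b (x y : A) →
  (b ≡ true × (if b then x else y) ≡ x) ⊎ (b ≡ false × (if b then x else y) ≡ y)
if-cases true  x y = inj₁ (refl , refl)
if-cases false x y = inj₂ (refl , refl)

≡ᵇ-true⁻ : ∀ m n → (m ≡ᵇ n) ≡ true → m ≡ n
≡ᵇ-true⁻ m n p = ≡ᵇ⇒≡ m n (Equivalence.from T-≡ p)

≡ᵇ-refl : ∀ m → (m ≡ᵇ m) ≡ true
≡ᵇ-refl zero    = refl
≡ᵇ-refl (suc m) = ≡ᵇ-refl m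

≡⇒≡ᵇ-true : ∀ {m n} → m ≡ n → (m ≡ᵇ n) ≡ true
≡⇒≡ᵇ-true {m} refl = ≡ᵇ-refl m

≢⇒≡ᵇ-false : ∀ {m n} → m ≢ n → (m ≡ᵇ n) ≡ false
≢⇒≡ᵇ-false {m} {n} m≢n = ¬true⇒false (λ p → m≢n (≡ᵇ-true⁻ m n p))

≤ᵇ-true⁻ : ∀ m n → (m ≤ᵇ n) ≡ true → m ≤ n
≤ᵇ-true⁻ m n p = ≤ᵇ⇒≤ m n (Equivalence.from T-≡ p)

≤⇒≤ᵇ-true : ∀ {m n} → m ≤ n → (m ≤ᵇ n) ≡ true
≤⇒≤ᵇ-true m≤n = Equivalence.to T-≡ (≤⇒≤ᵇ m≤n)

≔-same : ∀ (ν : Valuation) x c → (ν [ x ≔ c ]) x ≡ c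
≔-same ν x c rewrite ≡ᵇ-refl x = refl

≔-other : ∀ (ν : Valuation) x c z → z ≢ x → (ν [ x ≔ c ]) z ≡ ν z
≔-other ν x c z z≢x rewrite ≢⇒≡ᵇ-false z≢x = refl

≔-otherᵇ : ∀ (ν : Valuation) x c z → (z ≡ᵇ x) ≡ false → (ν [ x ≔ c ]) z ≡ ν z
≔-otherᵇ ν x c z p rewrite p = refl

elemᵇ : Var → List Var → Bool
elemᵇ z []       = false
elemᵇ z (x ∷ xs) = (z ≡ᵇ x) ∨ elemᵇ z xs

elemᵇ-++ : ∀ z xs ys → elemᵇ z (xs ++ ys) ≡ elemᵇ z xs ∨ elemᵇ z ys
elemᵇ-++ z []       ys = refl
elemᵇ-++ z (x ∷ xs) ys rewrite elemᵇ-++ z xs ys = sym (∨-assoc (z ≡ᵇ x) (elemᵇ z xs) (elemᵇ z ys))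

elemᵇ-map⁺ : ∀ (f : Var → Var) xs x → elemᵇ x xs ≡ true → elemᵇ (f x) (L.map f xs) ≡ true
elemᵇ-map⁺ f (y ∷ xs) x p with ∨-true⁻ (x ≡ᵇ y) _ p
... | inj₁ q = ∨-trueˡ _ (≡⇒≡ᵇ-true (cong f (≡ᵇ-true⁻ _ _ q)))
... | inj₂ q = ∨-trueʳ (f x ≡ᵇ f y) (elemᵇ-map⁺ f xs x q)

∈⇒elemᵇ : ∀ y W → y ∈ W → elemᵇ y W ≡ true
∈⇒elemᵇ y (w ∷ W) (here refl) = ∨-trueˡ _ (≡ᵇ-refl y)
∈⇒elemᵇ y (w ∷ W) (there p)   = ∨-trueʳ (y ≡ᵇ w) (∈⇒elemᵇ y W p)

memᵇ≡elemᵇ : ∀ {k} z (v : Vec Var k) → memᵇ z v ≡ elemᵇ z (V.toList v)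
memᵇ≡elemᵇ z []      = refl
memᵇ≡elemᵇ z (x ∷ v) = cong ((z ≡ᵇ x) ∨_) (memᵇ≡elemᵇ z v)

memᵇ-map⁻ : ∀ {k} (f : Var → Var) (v : Vec Var k) z → memᵇ z (V.map f v) ≡ true → ∃ λ w → memᵇ w v ≡ true × f w ≡ z
memᵇ-map⁻ f [] z ()
memᵇ-map⁻ f (x ∷ v) z p with ∨-true⁻ (z ≡ᵇ f x) _ p
... | inj₁ q = x , ∨-trueˡ _ (≡ᵇ-refl x) , sym (≡ᵇ-true⁻ _ _ q)
... | inj₂ q = let (w , m , e) = memᵇ-map⁻ f v z q in w , ∨-trueʳ (w ≡ᵇ x) m , e

memᵇ-map⁺ : ∀ {k} (f : Var → Var) (v : Vec Var k) w → memᵇ w v ≡ true → memᵇ (f w) (V.map f v) ≡ true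
memᵇ-map⁺ f [] w ()
memᵇ-map⁺ f (x ∷ v) w p with ∨-true⁻ (w ≡ᵇ x) _ p
... | inj₁ q = ∨-trueˡ _ (≡⇒≡ᵇ-true (cong f (≡ᵇ-true⁻ _ _ q)))
... | inj₂ q = ∨-trueʳ (f w ≡ᵇ f x) (memᵇ-map⁺ f v w q)

map-cong-memᵇ : ∀ {k} {B : Set} (f g : Var → B) (v : Vec Var k) → (∀ z → memᵇ z v ≡ true → f z ≡ g z) → V.map f v ≡ V.map g v
map-cong-memᵇ f g [] h = refl
map-cong-memᵇ f g (x ∷ v) h = cong₂ _∷_ (h x (∨-trueˡ _ (≡ᵇ-refl x))) (map-cong-memᵇ f g v (λ z p → h z (∨-trueʳ (z ≡ᵇ x) p)))

elemᵇ-filterᵇ⁻ : ∀ f z xs → elemᵇ z (filterᵇ f xs) ≡ true → elemᵇ z xs ≡ true × f z ≡ true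
elemᵇ-filterᵇ⁻ f z (x ∷ xs) p with f x in fx
... | true with ∨-true⁻ (z ≡ᵇ x) _ p
...   | inj₁ q = ∨-trueˡ _ q , subst (λ w → f w ≡ true) (sym (≡ᵇ-true⁻ z x q)) fx
...   | inj₂ q = let (a , b) = elemᵇ-filterᵇ⁻ f z xs q in ∨-trueʳ (z ≡ᵇ x) a , b
elemᵇ-filterᵇ⁻ f z (x ∷ xs) p | false = let (a , b) = elemᵇ-filterᵇ⁻ f z xs p in ∨-trueʳ (z ≡ᵇ x) a , b

elemᵇ-filterᵇ⁺ : ∀ f z xs → elemᵇ z xs ≡ true → f z ≡ true → elemᵇ z (filterᵇ f xs) ≡ true
elemᵇ-filterᵇ⁺ f z (x ∷ xs) p fz with ∨-true⁻ (z ≡ᵇ x) _ p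
... | inj₁ q with ≡ᵇ-true⁻ z x q
...   | refl rewrite fz = ∨-trueˡ _ q
elemᵇ-filterᵇ⁺ f z (x ∷ xs) p fz | inj₂ q with f x
... | true  = ∨-trueʳ (z ≡ᵇ x) (elemᵇ-filterᵇ⁺ f z xs q fz)
... | false = elemᵇ-filterᵇ⁺ f z xs q fz

strictBound : List Var → ℕ
strictBound []       = 0
strictBound (x ∷ xs) = suc x + strictBound xs

elemᵇ⇒<strictBound : ∀ z xs → elemᵇ z xs ≡ true → z < strictBound xs
elemᵇ⇒<strictBound z (x ∷ xs) p with ∨-true⁻ (z ≡ᵇ x) _ p
... | inj₁ q rewrite ≡ᵇ-true⁻ z x q = m≤m+n (suc x) (strictBound xs)
... | inj₂ q = <-≤-trans (elemᵇ⇒<strictBound z xs q) (m≤n+m (strictBound xs) (suc x))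

module _ {S : Schema} where

  variables outputs : Expr S → List Var
  variables (atom R xs ys) = V.toList xs ++ V.toList ys
  variables (eqv x y)      = x ∷ y ∷ []
  variables (eqc x c)      = x ∷ []
  variables (asgv x y)     = x ∷ y ∷ []
  variables (asgc x c)     = x ∷ []
  variables (a ⨾ b)        = variables a ++ variables b
  variables (a ∪ₑ b)       = variables a ++ variables b
  variables (a −ₑ b)       = variables a ++ variables b
  outputs (atom R xs ys) = V.toList ys
  outputs (eqv x y)      = []
  outputs (eqc x c)      = []
  outputs (asgv x y)     = x ∷ []
  outputs (asgc x c)     = x ∷ []
  outputs (a ⨾ b)        = outputs a ++ outputs b
  outputs (a ∪ₑ b)       = outputs a ++ outputs b
  outputs (a −ₑ b)       = outputs a

  vars≡elemᵇ-variables : ∀ e z → vars e z ≡ elemᵇ z (variables e)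
  vars≡elemᵇ-variables (atom R xs ys) z
    rewrite elemᵇ-++ z (V.toList xs) (V.toList ys) = cong₂ _∨_ (memᵇ≡elemᵇ z xs) (memᵇ≡elemᵇ z ys)
  vars≡elemᵇ-variables (eqv x y)  z = cong ((z ≡ᵇ x) ∨_) (sym (∨-identityʳ _))
  vars≡elemᵇ-variables (eqc x c)  z = sym (∨-identityʳ _)
  vars≡elemᵇ-variables (asgv x y) z = cong ((z ≡ᵇ x) ∨_) (sym (∨-identityʳ _))
  vars≡elemᵇ-variables (asgc x c) z = sym (∨-identityʳ _)
  vars≡elemᵇ-variables (a ⨾ b)  z
    rewrite elemᵇ-++ z (variables a) (variables b) = cong₂ _∨_ (vars≡elemᵇ-variables a z) (vars≡elemᵇ-variables b z)
  vars≡elemᵇ-variables (a ∪ₑ b) z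
    rewrite elemᵇ-++ z (variables a) (variables b) = cong₂ _∨_ (vars≡elemᵇ-variables a z) (vars≡elemᵇ-variables b z)
  vars≡elemᵇ-variables (a −ₑ b) z
    rewrite elemᵇ-++ z (variables a) (variables b) = cong₂ _∨_ (vars≡elemᵇ-variables a z) (vars≡elemᵇ-variables b z)

  O≡elemᵇ-outputs : ∀ e z → O e z ≡ elemᵇ z (outputs e)
  O≡elemᵇ-outputs (atom R xs ys) z = memᵇ≡elemᵇ z ys
  O≡elemᵇ-outputs (eqv x y)  z = refl
  O≡elemᵇ-outputs (eqc x c)  z = refl
  O≡elemᵇ-outputs (asgv x y) z = sym (∨-identityʳ _)
  O≡elemᵇ-outputs (asgc x c) z = sym (∨-identityʳ _)
  O≡elemᵇ-outputs (a ⨾ b)  z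
    rewrite elemᵇ-++ z (outputs a) (outputs b) = cong₂ _∨_ (O≡elemᵇ-outputs a z) (O≡elemᵇ-outputs b z)
  O≡elemᵇ-outputs (a ∪ₑ b) z
    rewrite elemᵇ-++ z (outputs a) (outputs b) = cong₂ _∨_ (O≡elemᵇ-outputs a z) (O≡elemᵇ-outputs b z)
  O≡elemᵇ-outputs (a −ₑ b) z = O≡elemᵇ-outputs a z

  varBound : Expr S → ℕ
  varBound e = strictBound (variables e)

  vars<varBound : ∀ e z → vars e z ≡ true → z < varBound e
  vars<varBound e z p = elemᵇ⇒<strictBound z (variables e) (trans (sym (vars≡elemᵇ-variables e z)) p)

  O⊆vars : ∀ (e : Expr S) z → O e z ≡ true → vars e z ≡ true
  O⊆vars (atom R xs ys) z p = ∨-trueʳ (memᵇ z xs) p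
  O⊆vars (eqv x y)  z ()
  O⊆vars (eqc x c)  z ()
  O⊆vars (asgv x y) z p = ∨-trueˡ _ p
  O⊆vars (asgc x c) z p = p
  O⊆vars (a ⨾ b)  z p = [ ∨-trueˡ _ ∘ O⊆vars a z , ∨-trueʳ (vars a z) ∘ O⊆vars b z ] (∨-true⁻ (O a z) _ p)
  O⊆vars (a ∪ₑ b) z p = [ ∨-trueˡ _ ∘ O⊆vars a z , ∨-trueʳ (vars a z) ∘ O⊆vars b z ] (∨-true⁻ (O a z) _ p)
  O⊆vars (a −ₑ b) z p = ∨-trueˡ _ (O⊆vars a z p)

  I⊆vars : ∀ (e : Expr S) z → I e z ≡ true → vars e z ≡ true
  I-binary⊆vars : ∀ a b z → (I a z ∨ I b z ∨ xorᵇ (O a z) (O b z)) ≡ true → (vars a z ∨ vars b z) ≡ true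
  I⊆vars (atom R xs ys) z p = ∨-trueˡ _ p
  I⊆vars (eqv x y)  z p = p
  I⊆vars (eqc x c)  z p = p
  I⊆vars (asgv x y) z p = ∨-trueʳ (z ≡ᵇ x) p
  I⊆vars (asgc x c) z ()
  I⊆vars (a ⨾ b) z p with ∨-true⁻ (I a z) _ p
  ... | inj₁ q = ∨-trueˡ _ (I⊆vars a z q)
  ... | inj₂ q = ∨-trueʳ (vars a z) (I⊆vars b z (proj₁ (∧-true⁻ _ _ q)))
  I⊆vars (a ∪ₑ b) z p = I-binary⊆vars a b z p
  I⊆vars (a −ₑ b) z p = I-binary⊆vars a b z p

  I-binary⊆vars a b z p with ∨-true⁻ (I a z) _ p
  ... | inj₁ q = ∨-trueˡ _ (I⊆vars a z q)
  ... | inj₂ q with ∨-true⁻ (I b z) _ q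
  ...   | inj₁ r = ∨-trueʳ (vars a z) (I⊆vars b z r)
  ...   | inj₂ r with xor-true⁻ (O a z) (O b z) r
  ...     | inj₁ (s , _) = ∨-trueˡ _ (O⊆vars a z s)
  ...     | inj₂ (_ , s) = ∨-trueʳ (vars a z) (O⊆vars b z s)

  ⟦⟧-frame : ∀ (e : Expr S) D ν₁ ν₂ → ⟦ e ⟧ D ν₁ ν₂ → ∀ z → O e z ≡ false → ν₁ z ≡ ν₂ z
  ⟦⟧-frame (atom R xs ys) D ν₁ ν₂ (_ , f) z p = f z p
  ⟦⟧-frame (eqv x y)  D ν₁ ν₂ (e , _) z p = e z
  ⟦⟧-frame (eqc x c)  D ν₁ ν₂ (e , _) z p = e z
  ⟦⟧-frame (asgv x y) D ν₁ ν₂ e z p = trans (sym (≔-otherᵇ ν₁ x (ν₁ y) z p)) (e z)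
  ⟦⟧-frame (asgc x c) D ν₁ ν₂ e z p = trans (sym (≔-otherᵇ ν₁ x c z p)) (e z)
  ⟦⟧-frame (a ⨾ b) D ν₁ ν₂ (ν , h₁ , h₂) z p =
    trans (⟦⟧-frame a D ν₁ ν h₁ z (∨-falseˡ⁻ _ _ p)) (⟦⟧-frame b D ν ν₂ h₂ z (∨-falseʳ⁻ (O a z) _ p))
  ⟦⟧-frame (a ∪ₑ b) D ν₁ ν₂ (inj₁ h) z p = ⟦⟧-frame a D ν₁ ν₂ h z (∨-falseˡ⁻ _ _ p)
  ⟦⟧-frame (a ∪ₑ b) D ν₁ ν₂ (inj₂ h) z p = ⟦⟧-frame b D ν₁ ν₂ h z (∨-falseʳ⁻ (O a z) _ p)
  ⟦⟧-frame (a −ₑ b) D ν₁ ν₂ (h , _) z p = ⟦⟧-frame a D ν₁ ν₂ h z p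

  ⟦⟧-≐ : ∀ (e : Expr S) D ν₁ ν₂ ν₂′ → ⟦ e ⟧ D ν₁ ν₂ → ν₂ ≐ ν₂′ → ⟦ e ⟧ D ν₁ ν₂′
  ⟦⟧-≐ (atom R xs ys) D ν₁ ν₂ ν₂′ (d , f) q =
    subst (D R (V.map ν₁ xs)) (map-cong q ys) d , λ z p → trans (f z p) (q z)
  ⟦⟧-≐ (eqv x y)  D ν₁ ν₂ ν₂′ (e , h) q = (λ z → trans (e z) (q z)) , h
  ⟦⟧-≐ (eqc x c)  D ν₁ ν₂ ν₂′ (e , h) q = (λ z → trans (e z) (q z)) , h
  ⟦⟧-≐ (asgv x y) D ν₁ ν₂ ν₂′ e q = λ z → trans (e z) (q z)
  ⟦⟧-≐ (asgc x c) D ν₁ ν₂ ν₂′ e q = λ z → trans (e z) (q z)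
  ⟦⟧-≐ (a ⨾ b)  D ν₁ ν₂ ν₂′ (ν , h₁ , h₂) q = ν , h₁ , ⟦⟧-≐ b D ν ν₂ ν₂′ h₂ q
  ⟦⟧-≐ (a ∪ₑ b) D ν₁ ν₂ ν₂′ (inj₁ h) q = inj₁ (⟦⟧-≐ a D ν₁ ν₂ ν₂′ h q)
  ⟦⟧-≐ (a ∪ₑ b) D ν₁ ν₂ ν₂′ (inj₂ h) q = inj₂ (⟦⟧-≐ b D ν₁ ν₂ ν₂′ h q)
  ⟦⟧-≐ (a −ₑ b) D ν₁ ν₂ ν₂′ (h , nh) q =
    ⟦⟧-≐ a D ν₁ ν₂ ν₂′ h q , λ h′ → nh (⟦⟧-≐ b D ν₁ ν₂′ ν₂ h′ (λ z → sym (q z)))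

  root-io-disjoint : ∀ (e : Expr S) → IODisjoint e → IODisjNode e
  root-io-disjoint (atom R xs ys) d = d
  root-io-disjoint (eqv x y)  d = d
  root-io-disjoint (eqc x c)  d = d
  root-io-disjoint (asgv x y) d = d
  root-io-disjoint (asgc x c) d = d
  root-io-disjoint (a ⨾ b)  d = proj₁ d
  root-io-disjoint (a ∪ₑ b) d = proj₁ d
  root-io-disjoint (a −ₑ b) d = proj₁ d

Source : Set
Source = Var ⊎ Dom

Assignment : Set
Assignment = Var × Source

eval : Valuation → Source → Dom
eval μ (inj₁ s) = μ s
eval μ (inj₂ c) = c

reads : Source → Var → Bool
reads (inj₁ s) z = z ≡ᵇ s
reads (inj₂ c) z = false

run : List Assignment → Valuation → Valuation
run [] μ = μ
run ((t , s) ∷ A) μ = run A (μ [ t ≔ eval μ s ])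

targets : List Assignment → Var → Bool
targets [] z = false
targets ((t , s) ∷ A) z = (z ≡ᵇ t) ∨ targets A z

sources : List Assignment → Var → Bool
sources [] z = false
sources ((t , s) ∷ A) z = reads s z ∨ sources A z

Assigns : Var → Source → List Assignment → Set
Assigns t s [] = ⊥
Assigns t s ((t′ , s′) ∷ A) = (t′ ≡ t × s′ ≡ s) ⊎ Assigns t s A

assignments : (Var → Var) → (Var → Source) → List Var → List Assignment
assignments f g xs = L.map (λ x → (f x , g x)) xs

Test : Set
Test = Var × Var

testVars : List Test → Var → Bool
testVars [] z = false
testVars ((p , q) ∷ ts) z = ((z ≡ᵇ p) ∨ (z ≡ᵇ q)) ∨ testVars ts z

Passes : Valuation → List Test → Set
Passes ν [] = ⊤
Passes ν ((p , q) ∷ ts) = ν p ≡ ν q × Passes ν ts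

tests : (Var → Var) → (Var → Var) → List Var → List Test
tests f g xs = L.map (λ x → (f x , g x)) xs

targets-++ : ∀ A₁ A₂ z → targets (A₁ ++ A₂) z ≡ targets A₁ z ∨ targets A₂ z
targets-++ [] A₂ z = refl
targets-++ ((t , s) ∷ A₁) A₂ z rewrite targets-++ A₁ A₂ z = sym (∨-assoc (z ≡ᵇ t) _ _)

sources-++ : ∀ A₁ A₂ z → sources (A₁ ++ A₂) z ≡ sources A₁ z ∨ sources A₂ z
sources-++ [] A₂ z = refl
sources-++ ((t , s) ∷ A₁) A₂ z rewrite sources-++ A₁ A₂ z = sym (∨-assoc (reads s z) _ _)

Assigns-++⁻ : ∀ t s A₁ A₂ → Assigns t s (A₁ ++ A₂) → Assigns t s A₁ ⊎ Assigns t s A₂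
Assigns-++⁻ t s [] A₂ p = inj₂ p
Assigns-++⁻ t s ((t′ , s′) ∷ A₁) A₂ (inj₁ p) = inj₁ (inj₁ p)
Assigns-++⁻ t s ((t′ , s′) ∷ A₁) A₂ (inj₂ p) with Assigns-++⁻ t s A₁ A₂ p
... | inj₁ q = inj₁ (inj₂ q)
... | inj₂ q = inj₂ q

Assigns⇒sources : ∀ t w A → Assigns t (inj₁ w) A → sources A w ≡ true
Assigns⇒sources t w ((t′ , s′) ∷ A) (inj₁ (_ , refl)) = ∨-trueˡ _ (≡ᵇ-refl w)
Assigns⇒sources t w ((t′ , s′) ∷ A) (inj₂ p) = ∨-trueʳ (reads s′ w) (Assigns⇒sources t w A p)

run-untouched : ∀ A μ z → targets A z ≡ false → run A μ z ≡ μ z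
run-untouched [] μ z p = refl
run-untouched ((t , s) ∷ A) μ z p =
  trans (run-untouched A _ z (∨-falseʳ⁻ (z ≡ᵇ t) _ p)) (≔-otherᵇ μ t _ z (∨-falseˡ⁻ _ _ p))

eval-cong : ∀ {μ μ′} s → μ ≐ μ′ → eval μ s ≡ eval μ′ s
eval-cong (inj₁ x) q = q x
eval-cong (inj₂ c) q = refl

≔-cong : ∀ {μ μ′ : Valuation} t {c c′} → μ ≐ μ′ → c ≡ c′ → (μ [ t ≔ c ]) ≐ (μ′ [ t ≔ c′ ])
≔-cong t q refl z with z ≡ᵇ t
... | true = refl
... | false = q z

run-cong : ∀ A {μ μ′} → μ ≐ μ′ → run A μ ≐ run A μ′
run-cong [] q = q
run-cong ((t , s) ∷ A) q = run-cong A (≔-cong t q (eval-cong s q))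

run-assigned : ∀ A μ t v → targets A t ≡ true → (∀ s → Assigns t s A → eval μ s ≡ v)
  → (∀ z → targets A z ≡ true → sources A z ≡ false) → run A μ t ≡ v
run-assigned [] μ t v () _ _
run-assigned ((t′ , s′) ∷ A) μ t v p ps ns with targets A t in eq
... | true = run-assigned A (μ [ t′ ≔ eval μ s′ ]) t v eq ps′ ns′
  where
  ns′ : ∀ z → targets A z ≡ true → sources A z ≡ false
  ns′ z q = ∨-falseʳ⁻ (reads s′ z) _ (ns z (∨-trueʳ (z ≡ᵇ t′) q))
  ps′ : ∀ s → Assigns t s A → eval (μ [ t′ ≔ eval μ s′ ]) s ≡ v
  ps′ (inj₂ c) q = ps (inj₂ c) (inj₂ q)
  ps′ (inj₁ w) q = trans (≔-other μ t′ _ w wt) (ps (inj₁ w) (inj₂ q))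
    where
    wt : w ≡ t′ → ⊥
    wt refl = true≢false (∨-trueʳ (reads s′ t′) (Assigns⇒sources t t′ A q)) (ns t′ (∨-trueˡ _ (≡ᵇ-refl t′)))
... | false with ≡ᵇ-true⁻ t t′ (subst (λ b → b ≡ true) (∨-identityʳ (t ≡ᵇ t′)) p)
...   | refl = trans (run-untouched A _ t eq) (trans (≔-same μ t _) (ps s′ (inj₁ (refl , refl))))

targets-assignments⁻ : ∀ f g xs z → targets (assignments f g xs) z ≡ true → ∃ λ x → elemᵇ x xs ≡ true × f x ≡ z
targets-assignments⁻ f g [] z ()
targets-assignments⁻ f g (x ∷ xs) z p with ∨-true⁻ (z ≡ᵇ f x) _ p
... | inj₁ q = x , ∨-trueˡ _ (≡ᵇ-refl x) , sym (≡ᵇ-true⁻ _ _ q)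
... | inj₂ q = let (y , m , e) = targets-assignments⁻ f g xs z q in y , ∨-trueʳ (y ≡ᵇ x) m , e

targets-assignments⁺ : ∀ f g xs x → elemᵇ x xs ≡ true → targets (assignments f g xs) (f x) ≡ true
targets-assignments⁺ f g [] x ()
targets-assignments⁺ f g (y ∷ xs) x p with ∨-true⁻ (x ≡ᵇ y) _ p
... | inj₁ q = ∨-trueˡ _ (≡⇒≡ᵇ-true (cong f (≡ᵇ-true⁻ _ _ q)))
... | inj₂ q = ∨-trueʳ (f x ≡ᵇ f y) (targets-assignments⁺ f g xs x q)

sources-assignments⁻ : ∀ f g xs z → sources (assignments f g xs) z ≡ true → ∃ λ x → elemᵇ x xs ≡ true × reads (g x) z ≡ true
sources-assignments⁻ f g [] z ()
sources-assignments⁻ f g (x ∷ xs) z p with ∨-true⁻ (reads (g x) z) _ p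
... | inj₁ q = x , ∨-trueˡ _ (≡ᵇ-refl x) , q
... | inj₂ q = let (y , m , e) = sources-assignments⁻ f g xs z q in y , ∨-trueʳ (y ≡ᵇ x) m , e

sources-assignments⁺ : ∀ f g xs x z → elemᵇ x xs ≡ true → reads (g x) z ≡ true → sources (assignments f g xs) z ≡ true
sources-assignments⁺ f g [] x z ()
sources-assignments⁺ f g (y ∷ xs) x z p s with ∨-true⁻ (x ≡ᵇ y) _ p
... | inj₁ q = ∨-trueˡ _ (subst (λ w → reads (g w) z ≡ true) (≡ᵇ-true⁻ _ _ q) s)
... | inj₂ q = ∨-trueʳ (reads (g y) z) (sources-assignments⁺ f g xs x z q s)

Assigns-assignments⁻ : ∀ f g xs t s → Assigns t s (assignments f g xs) → ∃ λ x → elemᵇ x xs ≡ true × f x ≡ t × g x ≡ s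
Assigns-assignments⁻ f g [] t s ()
Assigns-assignments⁻ f g (x ∷ xs) t s (inj₁ (a , b)) = x , ∨-trueˡ _ (≡ᵇ-refl x) , a , b
Assigns-assignments⁻ f g (x ∷ xs) t s (inj₂ p) = let (y , m , a , b) = Assigns-assignments⁻ f g xs t s p in y , ∨-trueʳ (y ≡ᵇ x) m , a , b

sources-constants : ∀ (f : Var → Var) (h : Var → Dom) xs z → sources (assignments f (λ y → inj₂ (h y)) xs) z ≡ false
sources-constants f h xs z = ¬true⇒false (λ p → let (x , _ , s) = sources-assignments⁻ f (λ y → inj₂ (h y)) xs z p in true≢false s refl)

zeroAll : List Var → List Assignment
zeroAll = assignments (λ t → t) (λ _ → inj₂ 0)

targets-zeroAll : ∀ xs z → targets (zeroAll xs) z ≡ elemᵇ z xs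
targets-zeroAll []       z = refl
targets-zeroAll (x ∷ xs) z = cong ((z ≡ᵇ x) ∨_) (targets-zeroAll xs z)

run-zeroAll : ∀ xs μ z → elemᵇ z xs ≡ true → run (zeroAll xs) μ z ≡ 0
run-zeroAll xs μ z p = run-assigned (zeroAll xs) μ z 0 (trans (targets-zeroAll xs z) p) const-0
  (λ z′ _ → sources-constants (λ t → t) (λ _ → 0) xs z′)
  where
  const-0 : ∀ s → Assigns z s (zeroAll xs) → eval μ s ≡ 0
  const-0 s pr with Assigns-assignments⁻ (λ t → t) _ xs z s pr
  ... | _ , _ , _ , refl = refl

testVars-++ : ∀ ts₁ ts₂ z → testVars (ts₁ ++ ts₂) z ≡ testVars ts₁ z ∨ testVars ts₂ z
testVars-++ [] ts₂ z = refl
testVars-++ ((p , q) ∷ ts₁) ts₂ z rewrite testVars-++ ts₁ ts₂ z = sym (∨-assoc ((z ≡ᵇ p) ∨ (z ≡ᵇ q)) _ _)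

Passes-++⁻ : ∀ ν ts₁ ts₂ → Passes ν (ts₁ ++ ts₂) → Passes ν ts₁ × Passes ν ts₂
Passes-++⁻ ν [] ts₂ h = tt , h
Passes-++⁻ ν ((p , q) ∷ ts₁) ts₂ (e , h) = let (a , b) = Passes-++⁻ ν ts₁ ts₂ h in (e , a) , b

Passes-++⁺ : ∀ ν ts₁ ts₂ → Passes ν ts₁ → Passes ν ts₂ → Passes ν (ts₁ ++ ts₂)
Passes-++⁺ ν [] ts₂ _ h = h
Passes-++⁺ ν ((p , q) ∷ ts₁) ts₂ (e , h₁) h₂ = e , Passes-++⁺ ν ts₁ ts₂ h₁ h₂

Passes-tests⁻ : ∀ ν f g xs → Passes ν (tests f g xs) → ∀ x → elemᵇ x xs ≡ true → ν (f x) ≡ ν (g x)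
Passes-tests⁻ ν f g [] h x ()
Passes-tests⁻ ν f g (y ∷ xs) (e , h) x p with ∨-true⁻ (x ≡ᵇ y) _ p
... | inj₁ q = subst (λ w → ν (f w) ≡ ν (g w)) (sym (≡ᵇ-true⁻ _ _ q)) e
... | inj₂ q = Passes-tests⁻ ν f g xs h x q

Passes-tests⁺ : ∀ ν f g xs → (∀ x → elemᵇ x xs ≡ true → ν (f x) ≡ ν (g x)) → Passes ν (tests f g xs)
Passes-tests⁺ ν f g [] h = tt
Passes-tests⁺ ν f g (y ∷ xs) h = h y (∨-trueˡ _ (≡ᵇ-refl y)) , Passes-tests⁺ ν f g xs (λ x p → h x (∨-trueʳ (x ≡ᵇ y) p))

testVars-tests⁻ : ∀ f g xs z → testVars (tests f g xs) z ≡ true → ∃ λ x → elemᵇ x xs ≡ true × (f x ≡ z ⊎ g x ≡ z)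
testVars-tests⁻ f g [] z ()
testVars-tests⁻ f g (x ∷ xs) z p with ∨-true⁻ ((z ≡ᵇ f x) ∨ (z ≡ᵇ g x)) _ p
... | inj₁ q with ∨-true⁻ (z ≡ᵇ f x) _ q
...   | inj₁ r = x , ∨-trueˡ _ (≡ᵇ-refl x) , inj₁ (sym (≡ᵇ-true⁻ _ _ r))
...   | inj₂ r = x , ∨-trueˡ _ (≡ᵇ-refl x) , inj₂ (sym (≡ᵇ-true⁻ _ _ r))
testVars-tests⁻ f g (x ∷ xs) z p | inj₂ q = let (y , m , e) = testVars-tests⁻ f g xs z q in y , ∨-trueʳ (y ≡ᵇ x) m , e

testVars-testsʳ⁺ : ∀ f g xs x → elemᵇ x xs ≡ true → testVars (tests f g xs) (g x) ≡ true
testVars-testsʳ⁺ f g [] x ()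
testVars-testsʳ⁺ f g (y ∷ xs) x p with ∨-true⁻ (x ≡ᵇ y) _ p
... | inj₁ q = ∨-trueˡ _ (∨-trueʳ (g x ≡ᵇ f y) (≡⇒≡ᵇ-true (cong g (≡ᵇ-true⁻ _ _ q))))
... | inj₂ q = ∨-trueʳ ((g x ≡ᵇ f y) ∨ (g x ≡ᵇ g y)) (testVars-testsʳ⁺ f g xs x q)

module _ {S : Schema} where

  assign : Var → Source → Expr S
  assign t (inj₁ s) = asgv t s
  assign t (inj₂ c) = asgc t c

  thenAssign : Expr S → List Assignment → Expr S
  thenAssign e [] = e
  thenAssign e ((t , s) ∷ A) = thenAssign (e ⨾ assign t s) A

  thenTest : Expr S → List Test → Expr S
  thenTest e [] = e
  thenTest e ((p , q) ∷ ts) = thenTest (e ⨾ eqv p q) ts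

  O-assign : ∀ t s z → O (assign t s) z ≡ (z ≡ᵇ t)
  O-assign t (inj₁ s) z = refl
  O-assign t (inj₂ c) z = refl

  I-assign : ∀ t s z → I (assign t s) z ≡ reads s z
  I-assign t (inj₁ s) z = refl
  I-assign t (inj₂ c) z = refl

  ⟦assign⟧⁻ : ∀ t s D μ μ′ → ⟦ assign t s ⟧ D μ μ′ → (μ [ t ≔ eval μ s ]) ≐ μ′
  ⟦assign⟧⁻ t (inj₁ s) D μ μ′ h = h
  ⟦assign⟧⁻ t (inj₂ c) D μ μ′ h = h

  ⟦assign⟧⁺ : ∀ t s D μ → ⟦ assign t s ⟧ D μ (μ [ t ≔ eval μ s ])
  ⟦assign⟧⁺ t (inj₁ s) D μ z = refl
  ⟦assign⟧⁺ t (inj₂ c) D μ z = refl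

  O-thenAssign : ∀ e A z → O (thenAssign e A) z ≡ O e z ∨ targets A z
  O-thenAssign e [] z = sym (∨-identityʳ _)
  O-thenAssign e ((t , s) ∷ A) z rewrite O-thenAssign (e ⨾ assign t s) A z | O-assign t s z = ∨-assoc (O e z) _ _

  I-thenAssign⁻ : ∀ e A z → I (thenAssign e A) z ≡ true → I e z ≡ true ⊎ (sources A z ≡ true × O e z ≡ false)
  I-thenAssign⁻ e [] z p = inj₁ p
  I-thenAssign⁻ e ((t , s) ∷ A) z p with I-thenAssign⁻ (e ⨾ assign t s) A z p
  ... | inj₂ (a , b) = inj₂ (∨-trueʳ (reads s z) a , ∨-falseˡ⁻ _ _ b)
  ... | inj₁ q with ∨-true⁻ (I e z) _ q
  ...   | inj₁ r = inj₁ r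
  ...   | inj₂ r = let (a , b) = ∧-true⁻ _ _ r in
                   inj₂ (∨-trueˡ _ (trans (sym (I-assign t s z)) a) , not-true⁻ _ b)

  I-thenAssign⁺ˡ : ∀ e A z → I e z ≡ true → I (thenAssign e A) z ≡ true
  I-thenAssign⁺ˡ e [] z p = p
  I-thenAssign⁺ˡ e ((t , s) ∷ A) z p = I-thenAssign⁺ˡ (e ⨾ assign t s) A z (∨-trueˡ _ p)

  I-thenAssign⁺ʳ : ∀ e A z → sources A z ≡ true → O e z ≡ false → targets A z ≡ false → I (thenAssign e A) z ≡ true
  I-thenAssign⁺ʳ e [] z () _ _
  I-thenAssign⁺ʳ e ((t , s) ∷ A) z p o nt with ∨-true⁻ (reads s z) _ p
  ... | inj₁ q = I-thenAssign⁺ˡ (e ⨾ assign t s) A z (∨-trueʳ (I e z) (∧-true (trans (I-assign t s z) q) (not-true o)))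
  ... | inj₂ q = I-thenAssign⁺ʳ (e ⨾ assign t s) A z q
                   (∨-false o (trans (O-assign t s z) (∨-falseˡ⁻ _ _ nt))) (∨-falseʳ⁻ (z ≡ᵇ t) _ nt)

  io-disjoint-assign : ∀ t s → reads s t ≡ false → IODisjoint (assign t s)
  io-disjoint-assign t (inj₁ w) t≢w z z≡w with ≡ᵇ-true⁻ z w z≡w
  ... | refl = ≢⇒≡ᵇ-false {z} {t} (λ { refl → true≢false z≡w t≢w })
  io-disjoint-assign t (inj₂ c) _ z ()

  io-disjoint-thenAssign : ∀ e A → IODisjoint e → (∀ z → targets A z ≡ true → I e z ≡ false)
    → (∀ z → targets A z ≡ true → sources A z ≡ false) → IODisjoint (thenAssign e A)
  io-disjoint-thenAssign e [] d _ _ = d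
  io-disjoint-thenAssign e ((t , s) ∷ A) d tgt∉I tgt∉src =
    io-disjoint-thenAssign (e ⨾ assign t s) A (root , d , io-disjoint-assign t s t∉s) tgt∉I′ tgt∉src′
    where
    t-tgt : targets ((t , s) ∷ A) t ≡ true
    t-tgt = ∨-trueˡ _ (≡ᵇ-refl t)
    t∉s : reads s t ≡ false
    t∉s = ∨-falseˡ⁻ _ _ (tgt∉src t t-tgt)
    ≢t : ∀ {z} → I (assign t s) z ≡ true ⊎ I e z ≡ true → (z ≡ᵇ t) ≡ false
    ≢t {z} i = ≢⇒≡ᵇ-false {z} {t} λ { refl → [ (λ p → true≢false (trans (sym (I-assign t s t)) p) t∉s)
                                     , (λ p → true≢false p (tgt∉I t t-tgt)) ] i }
    root : IODisjNode (e ⨾ assign t s)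
    root z p with ∨-true⁻ (I e z) _ p
    ... | inj₁ q = ∨-false (root-io-disjoint e d z q) (trans (O-assign t s z) (≢t (inj₂ q)))
    ... | inj₂ q = let (a , b) = ∧-true⁻ _ _ q in
      ∨-false (not-true⁻ _ b) (trans (O-assign t s z) (≢t (inj₁ a)))
    tgt∉src′ : ∀ z → targets A z ≡ true → sources A z ≡ false
    tgt∉src′ z q = ∨-falseʳ⁻ (reads s z) _ (tgt∉src z (∨-trueʳ (z ≡ᵇ t) q))
    tgt∉I′ : ∀ z → targets A z ≡ true → I (e ⨾ assign t s) z ≡ false
    tgt∉I′ z q = ∨-false (tgt∉I z (∨-trueʳ (z ≡ᵇ t) q))
      (¬true⇒false (λ r → true≢false (trans (sym (I-assign t s z)) (proj₁ (∧-true⁻ _ _ r)))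
                                     (∨-falseˡ⁻ _ _ (tgt∉src z (∨-trueʳ (z ≡ᵇ t) q)))))

  ⟦thenAssign⟧⁻ : ∀ e A D ν₁ ν₂ → ⟦ thenAssign e A ⟧ D ν₁ ν₂ → ∃ λ μ → ⟦ e ⟧ D ν₁ μ × ν₂ ≐ run A μ
  ⟦thenAssign⟧⁻ e [] D ν₁ ν₂ h = ν₂ , h , λ z → refl
  ⟦thenAssign⟧⁻ e ((t , s) ∷ A) D ν₁ ν₂ h with ⟦thenAssign⟧⁻ (e ⨾ assign t s) A D ν₁ ν₂ h
  ... | μ′ , (μ , h₁ , h₂) , q =
    μ , h₁ , λ z → trans (q z) (sym (run-cong A (⟦assign⟧⁻ t s D μ μ′ h₂) z))

  ⟦thenAssign⟧⁺ : ∀ e A D ν₁ μ → ⟦ e ⟧ D ν₁ μ → ⟦ thenAssign e A ⟧ D ν₁ (run A μ)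
  ⟦thenAssign⟧⁺ e [] D ν₁ μ h = h
  ⟦thenAssign⟧⁺ e ((t , s) ∷ A) D ν₁ μ h =
    ⟦thenAssign⟧⁺ (e ⨾ assign t s) A D ν₁ (μ [ t ≔ eval μ s ]) (μ , h , ⟦assign⟧⁺ t s D μ)

  O-thenTest : ∀ e ts z → O (thenTest e ts) z ≡ O e z
  O-thenTest e [] z = refl
  O-thenTest e ((p , q) ∷ ts) z = trans (O-thenTest (e ⨾ eqv p q) ts z) (∨-identityʳ _)

  I-thenTest⁻ : ∀ e ts z → I (thenTest e ts) z ≡ true → I e z ≡ true ⊎ (testVars ts z ≡ true × O e z ≡ false)
  I-thenTest⁻ e [] z p = inj₁ p
  I-thenTest⁻ e ((p , q) ∷ ts) z h with I-thenTest⁻ (e ⨾ eqv p q) ts z h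
  ... | inj₂ (a , b) = inj₂ (∨-trueʳ ((z ≡ᵇ p) ∨ (z ≡ᵇ q)) a , trans (sym (∨-identityʳ _)) b)
  ... | inj₁ r with ∨-true⁻ (I e z) _ r
  ...   | inj₁ u = inj₁ u
  ...   | inj₂ u = let (a , b) = ∧-true⁻ _ _ u in inj₂ (∨-trueˡ _ a , not-true⁻ _ b)

  I-thenTest⁺ˡ : ∀ e ts z → I e z ≡ true → I (thenTest e ts) z ≡ true
  I-thenTest⁺ˡ e [] z h = h
  I-thenTest⁺ˡ e ((p , q) ∷ ts) z h = I-thenTest⁺ˡ (e ⨾ eqv p q) ts z (∨-trueˡ _ h)

  I-thenTest⁺ʳ : ∀ e ts z → testVars ts z ≡ true → O e z ≡ false → I (thenTest e ts) z ≡ true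
  I-thenTest⁺ʳ e [] z () _
  I-thenTest⁺ʳ e ((p , q) ∷ ts) z h o with ∨-true⁻ ((z ≡ᵇ p) ∨ (z ≡ᵇ q)) _ h
  ... | inj₁ r = I-thenTest⁺ˡ (e ⨾ eqv p q) ts z (∨-trueʳ (I e z) (∧-true r (not-true o)))
  ... | inj₂ r = I-thenTest⁺ʳ (e ⨾ eqv p q) ts z r (trans (∨-identityʳ _) o)

  io-disjoint-thenTest : ∀ e ts → IODisjoint e → IODisjoint (thenTest e ts)
  io-disjoint-thenTest e [] d = d
  io-disjoint-thenTest e ((p , q) ∷ ts) d = io-disjoint-thenTest (e ⨾ eqv p q) ts (nd , d , λ z _ → refl)
    where
    nd : IODisjNode (e ⨾ eqv p q)
    nd z h with ∨-true⁻ (I e z) _ h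
    ... | inj₁ r = trans (∨-identityʳ _) (root-io-disjoint e d z r)
    ... | inj₂ r = trans (∨-identityʳ _) (not-true⁻ _ (proj₂ (∧-true⁻ _ _ r)))

  ⟦thenTest⟧⁻ : ∀ e ts D ν₁ ν₂ → ⟦ thenTest e ts ⟧ D ν₁ ν₂ → ⟦ e ⟧ D ν₁ ν₂ × Passes ν₂ ts
  ⟦thenTest⟧⁻ e [] D ν₁ ν₂ h = h , tt
  ⟦thenTest⟧⁻ e ((p , q) ∷ ts) D ν₁ ν₂ h with ⟦thenTest⟧⁻ (e ⨾ eqv p q) ts D ν₁ ν₂ h
  ... | (μ , h₁ , (eq , pq)) , hs =
    ⟦⟧-≐ e D ν₁ μ ν₂ h₁ eq , (trans (sym (eq p)) (trans pq (eq q))) , hs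

  ⟦thenTest⟧⁺ : ∀ e ts D ν₁ ν₂ → ⟦ e ⟧ D ν₁ ν₂ → Passes ν₂ ts → ⟦ thenTest e ts ⟧ D ν₁ ν₂
  ⟦thenTest⟧⁺ e [] D ν₁ ν₂ h _ = h
  ⟦thenTest⟧⁺ e ((p , q) ∷ ts) D ν₁ ν₂ h (pq , hs) =
    ⟦thenTest⟧⁺ (e ⨾ eqv p q) ts D ν₁ ν₂ (ν₂ , h , (λ z → refl) , pq) hs

Agree : (Var → Bool) → (Var → Var) → Valuation → Valuation → Set
Agree X f ν μ = ∀ x → X x ≡ true → ν x ≡ μ (f x)

module _ {S : Schema} where

  -- σ renames the variables of α and ρ renames its outputs, all below n;
  -- variables from n on are free for auxiliary use.
  record Admissible (α : Expr S) (σ ρ : Var → Var) (n : ℕ) : Set where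
    field
      σ<    : ∀ z → vars α z ≡ true → σ z < n
      ρ<    : ∀ x → O α x ≡ true → ρ x < n
      ρ-inj : ∀ x y → O α x ≡ true → O α y ≡ true → ρ x ≡ ρ y → x ≡ y
      ρ≢σ   : ∀ x z → O α x ≡ true → vars α z ≡ true → ρ x ≡ σ z → ⊥

  Forward Backward : Instance S → Expr S → Expr S → (Var → Bool) → (Var → Var) → Valuation → Valuation → Set
  Forward  D α β X ρ ν₁ μ₁ = ∀ ν₂ → ⟦ α ⟧ D ν₁ ν₂ → ∃ λ μ₂ → ⟦ β ⟧ D μ₁ μ₂ × Agree X ρ ν₂ μ₂
  Backward D α β X ρ ν₁ μ₁ = ∀ μ₂ → ⟦ β ⟧ D μ₁ μ₂ → ∃ λ ν₂ → ⟦ α ⟧ D ν₁ ν₂ × Agree X ρ ν₂ μ₂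

  Simulates : Instance S → Expr S → Expr S → (Var → Var) → (Var → Var) → Set
  Simulates D α β σ ρ = ∀ ν₁ μ₁ → Agree (vars α) σ ν₁ μ₁ →
    Forward D α β (O α) ρ ν₁ μ₁ × Backward D α β (O α) ρ ν₁ μ₁

  record Translation (α : Expr S) (σ ρ : Var → Var) (n : ℕ) (β : Expr S) : Set₁ where
    field
      io-disjoint : IODisjoint β
      I-sound     : ∀ z → I β z ≡ true → ∃ λ w → I α w ≡ true × σ w ≡ z
      I-complete  : ∀ w → I α w ≡ true → I β (σ w) ≡ true
      O-complete  : ∀ x → O α x ≡ true → O β (ρ x) ≡ true
      O-sound     : ∀ y → O β y ≡ true → (∃ λ x → O α x ≡ true × ρ x ≡ y) ⊎ (n ≤ y)
      simulates   : ∀ D → Simulates D α β σ ρ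

  module _ {α : Expr S} {σ ρ : Var → Var} {n : ℕ} (adm : Admissible α σ ρ n) where
    open Admissible adm

    σ∉renamed-outputs : ∀ w y → vars α w ≡ true → σ w ≡ y → ¬ ((∃ λ x → O α x ≡ true × ρ x ≡ y) ⊎ (n ≤ y))
    σ∉renamed-outputs w y vw refl (inj₁ (x , ox , ρx≡σw)) = ρ≢σ x w ox vw ρx≡σw
    σ∉renamed-outputs w y vw refl (inj₂ n≤σw)             = <⇒≱ (σ< w vw) n≤σw

    node-io-disjoint : ∀ (e : Expr S)
      → (∀ z → I e z ≡ true → ∃ λ w → I α w ≡ true × σ w ≡ z)
      → (∀ y → O e y ≡ true → (∃ λ x → O α x ≡ true × ρ x ≡ y) ⊎ (n ≤ y))
      → IODisjNode e
    node-io-disjoint e I-sound O-sound z p with I-sound z p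
    ... | w , iw , σw≡z = ¬true⇒false λ q → σ∉renamed-outputs w z (I⊆vars α w iw) σw≡z (O-sound z q)

  translation-atom : ∀ R xs ys σ ρ n → Admissible (atom R xs ys) σ ρ n →
    Translation (atom R xs ys) σ ρ n (atom R (V.map σ xs) (V.map ρ ys))
  translation-atom R xs ys σ ρ n adm = record
    { io-disjoint = node-io-disjoint adm (atom R (V.map σ xs) (V.map ρ ys))
                      (memᵇ-map⁻ σ xs) (λ y p → inj₁ (memᵇ-map⁻ ρ ys y p))
    ; I-sound     = memᵇ-map⁻ σ xs
    ; I-complete  = memᵇ-map⁺ σ xs
    ; O-complete  = memᵇ-map⁺ ρ ys
    ; O-sound     = λ y p → inj₁ (memᵇ-map⁻ ρ ys y p)
    ; simulates   = λ D ν₁ μ₁ hv → forward D ν₁ μ₁ hv , backward D ν₁ μ₁ hv }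
    where
    open Admissible adm
    α β : Expr S
    α = atom R xs ys
    β = atom R (V.map σ xs) (V.map ρ ys)
    renamed-tuple : ∀ (ν μ : Valuation) {k} (vs : Vec Var k) (f : Var → Var) →
      (∀ x → memᵇ x vs ≡ true → ν x ≡ μ (f x)) → V.map μ (V.map f vs) ≡ V.map ν vs
    renamed-tuple ν μ vs f h = trans (sym (map-∘ μ f vs)) (map-cong-memᵇ _ _ vs (λ z p → sym (h z p)))
    forward : ∀ D ν₁ μ₁ → Agree (vars α) σ ν₁ μ₁ → Forward D α β (O α) ρ ν₁ μ₁
    forward D ν₁ μ₁ hv ν₂ (d , f) = μ₂ , (subst₂ (D R) (sym inp) (sym outp) d , fr) , agree
      where
      inp : V.map μ₁ (V.map σ xs) ≡ V.map ν₁ xs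
      inp = renamed-tuple ν₁ μ₁ xs σ (λ z p → hv z (∨-trueˡ _ p))
      store : List Assignment
      store = assignments ρ (λ y → inj₂ (ν₂ y)) (V.toList ys)
      μ₂ : Valuation
      μ₂ = run store μ₁
      agree : ∀ x → memᵇ x ys ≡ true → ν₂ x ≡ μ₂ (ρ x)
      agree x p = sym (run-assigned store μ₁ (ρ x) (ν₂ x)
        (targets-assignments⁺ ρ _ (V.toList ys) x (trans (sym (memᵇ≡elemᵇ x ys)) p))
        (λ s pr → let (x′ , m , e₁ , e₂) = Assigns-assignments⁻ ρ (λ y → inj₂ (ν₂ y)) (V.toList ys) (ρ x) s pr in
           subst (λ s → eval μ₁ s ≡ ν₂ x) e₂ (cong ν₂ (ρ-inj x′ x (trans (memᵇ≡elemᵇ x′ ys) m) p e₁)))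
        (λ z _ → sources-constants ρ ν₂ (V.toList ys) z))
      outp : V.map μ₂ (V.map ρ ys) ≡ V.map ν₂ ys
      outp = renamed-tuple ν₂ μ₂ ys ρ agree
      fr : ∀ z → memᵇ z (V.map ρ ys) ≡ false → μ₁ z ≡ μ₂ z
      fr z p = sym (run-untouched store μ₁ z (¬true⇒false λ q →
        let (x , m , e) = targets-assignments⁻ ρ _ (V.toList ys) z q in
        true≢false (subst (λ w → memᵇ w (V.map ρ ys) ≡ true) e (memᵇ-map⁺ ρ ys x (trans (memᵇ≡elemᵇ x ys) m))) p))
    backward : ∀ D ν₁ μ₁ → Agree (vars α) σ ν₁ μ₁ → Backward D α β (O α) ρ ν₁ μ₁
    backward D ν₁ μ₁ hv μ₂ (d , f) = ν₂ , (subst₂ (D R) inp (renamed-tuple ν₂ μ₂ ys ρ (λ x p → if-true p)) d , λ z p → sym (if-false p)) , λ x p → if-true p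
      where
      inp : V.map μ₁ (V.map σ xs) ≡ V.map ν₁ xs
      inp = renamed-tuple ν₁ μ₁ xs σ (λ z p → hv z (∨-trueˡ _ p))
      ν₂ : Valuation
      ν₂ z = if memᵇ z ys then μ₂ (ρ z) else ν₁ z

  translation-eqv : ∀ x y σ ρ n → Translation (eqv x y) σ ρ n (eqv (σ x) (σ y))
  translation-eqv x y σ ρ n = record
    { io-disjoint = λ z _ → refl
    ; I-sound     = I-sound
    ; I-complete  = I-complete
    ; O-complete  = λ _ ()
    ; O-sound     = λ _ ()
    ; simulates   = λ D ν₁ μ₁ hv →
        (λ ν₂ (ν₁≐ν₂ , h) → μ₁ , ((λ z → refl) , trans (sym (hx ν₁ μ₁ hv)) (trans h (hy ν₁ μ₁ hv))) , λ _ ())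
      , (λ μ₂ (μ₁≐μ₂ , h) → ν₁ , ((λ z → refl) , trans (hx ν₁ μ₁ hv) (trans h (sym (hy ν₁ μ₁ hv)))) , λ _ ()) }
    where
    I-sound : ∀ z → ((z ≡ᵇ σ x) ∨ (z ≡ᵇ σ y)) ≡ true → ∃ λ w → ((w ≡ᵇ x) ∨ (w ≡ᵇ y)) ≡ true × σ w ≡ z
    I-sound z p with ∨-true⁻ (z ≡ᵇ σ x) _ p
    ... | inj₁ q = x , ∨-trueˡ _ (≡ᵇ-refl x) , sym (≡ᵇ-true⁻ _ _ q)
    ... | inj₂ q = y , ∨-trueʳ (y ≡ᵇ x) (≡ᵇ-refl y) , sym (≡ᵇ-true⁻ _ _ q)
    I-complete : ∀ w → ((w ≡ᵇ x) ∨ (w ≡ᵇ y)) ≡ true → ((σ w ≡ᵇ σ x) ∨ (σ w ≡ᵇ σ y)) ≡ true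
    I-complete w p with ∨-true⁻ (w ≡ᵇ x) _ p
    ... | inj₁ q = ∨-trueˡ _ (≡⇒≡ᵇ-true (cong σ (≡ᵇ-true⁻ _ _ q)))
    ... | inj₂ q = ∨-trueʳ (σ w ≡ᵇ σ x) (≡⇒≡ᵇ-true (cong σ (≡ᵇ-true⁻ _ _ q)))
    hx : ∀ ν₁ μ₁ → Agree (vars {S} (eqv x y)) σ ν₁ μ₁ → ν₁ x ≡ μ₁ (σ x)
    hx ν₁ μ₁ hv = hv x (∨-trueˡ _ (≡ᵇ-refl x))
    hy : ∀ ν₁ μ₁ → Agree (vars {S} (eqv x y)) σ ν₁ μ₁ → ν₁ y ≡ μ₁ (σ y)
    hy ν₁ μ₁ hv = hv y (∨-trueʳ (y ≡ᵇ x) (≡ᵇ-refl y))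

  translation-eqc : ∀ x c σ ρ n → Translation (eqc x c) σ ρ n (eqc (σ x) c)
  translation-eqc x c σ ρ n = record
    { io-disjoint = λ z _ → refl
    ; I-sound     = λ z p → x , ≡ᵇ-refl x , sym (≡ᵇ-true⁻ _ _ p)
    ; I-complete  = λ w p → ≡⇒≡ᵇ-true (cong σ (≡ᵇ-true⁻ _ _ p))
    ; O-complete  = λ _ ()
    ; O-sound     = λ _ ()
    ; simulates   = λ D ν₁ μ₁ hv →
        (λ ν₂ (ν₁≐ν₂ , h) → μ₁ , ((λ z → refl) , trans (sym (hv x (≡ᵇ-refl x))) h) , λ _ ())
      , (λ μ₂ (μ₁≐μ₂ , h) → ν₁ , ((λ z → refl) , trans (hv x (≡ᵇ-refl x)) h) , λ _ ()) }

  ≔-agree : ∀ (ρ : Var → Var) (ν μ : Valuation) x {a b} → a ≡ b → Agree (_≡ᵇ x) ρ (ν [ x ≔ a ]) (μ [ ρ x ≔ b ])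
  ≔-agree ρ ν μ x {a} {b} a≡b x′ p with ≡ᵇ-true⁻ x′ x p
  ... | refl = trans (≔-same ν x a) (trans a≡b (sym (≔-same μ _ b)))

  translation-asgv : ∀ x y σ ρ n → Admissible (asgv x y) σ ρ n → Translation (asgv x y) σ ρ n (asgv (ρ x) (σ y))
  translation-asgv x y σ ρ n adm = record
    { io-disjoint = λ z p → ≢⇒≡ᵇ-false {z} {ρ x} (λ z≡ρx → ρ≢σ x y (≡ᵇ-refl x) (∨-trueʳ (y ≡ᵇ x) (≡ᵇ-refl y))
                                                            (trans (sym z≡ρx) (≡ᵇ-true⁻ _ _ p)))
    ; I-sound     = λ z p → y , ≡ᵇ-refl y , sym (≡ᵇ-true⁻ _ _ p)
    ; I-complete  = λ w p → ≡⇒≡ᵇ-true (cong σ (≡ᵇ-true⁻ _ _ p))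
    ; O-complete  = λ w p → ≡⇒≡ᵇ-true (cong ρ (≡ᵇ-true⁻ _ _ p))
    ; O-sound     = λ z p → inj₁ (x , ≡ᵇ-refl x , sym (≡ᵇ-true⁻ _ _ p))
    ; simulates   = λ D ν₁ μ₁ hv →
        let hy = hv y (∨-trueʳ (y ≡ᵇ x) (≡ᵇ-refl y)) in
        (λ ν₂ e → (μ₁ [ ρ x ≔ μ₁ (σ y) ]) , (λ z → refl) ,
                  λ x′ p → trans (sym (e x′)) (≔-agree ρ ν₁ μ₁ x hy x′ p))
      , (λ μ₂ e → (ν₁ [ x ≔ ν₁ y ]) , (λ z → refl) ,
                  λ x′ p → trans (≔-agree ρ ν₁ μ₁ x hy x′ p) (e (ρ x′))) }
    where open Admissible adm

  translation-asgc : ∀ x c σ ρ n → Translation (asgc x c) σ ρ n (asgc (ρ x) c)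
  translation-asgc x c σ ρ n = record
    { io-disjoint = λ z ()
    ; I-sound     = λ z ()
    ; I-complete  = λ w ()
    ; O-complete  = λ w p → ≡⇒≡ᵇ-true (cong ρ (≡ᵇ-true⁻ _ _ p))
    ; O-sound     = λ z p → inj₁ (x , ≡ᵇ-refl x , sym (≡ᵇ-true⁻ _ _ p))
    ; simulates   = λ D ν₁ μ₁ hv →
        (λ ν₂ e → (μ₁ [ ρ x ≔ c ]) , (λ z → refl) , λ x′ p → trans (sym (e x′)) (≔-agree ρ ν₁ μ₁ x refl x′ p))
      , (λ μ₂ e → (ν₁ [ x ≔ c ]) , (λ z → refl) , λ x′ p → trans (≔-agree ρ ν₁ μ₁ x refl x′ p) (e (ρ x′))) }

module _ {S : Schema} where

  O-outside : ∀ {α β : Expr S} {σ ρ n} → Translation α σ ρ n β →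
    ∀ y → y < n → (∀ x → O α x ≡ true → ρ x ≢ y) → O β y ≡ false
  O-outside t y y<n ρ≢y = ¬true⇒false λ q →
    [ (λ { (x , ox , ρx≡y) → ρ≢y x ox ρx≡y }) , <⇒≱ y<n ] (Translation.O-sound t y q)

  ρ-left : Expr S → (Var → Var) → ℕ → Var → Var
  ρ-left b ρ m x = if O b x then m + x else ρ x

  σ-right : Expr S → (Var → Var) → (Var → Var) → Var → Var
  σ-right a σ ρ₁ x = if O a x then ρ₁ x else σ x

module Sequence {S : Schema} (a b : Expr S) (σ ρ : Var → Var) (n : ℕ) (adm : Admissible (a ⨾ b) σ ρ n) where
  open Admissible adm

  α : Expr S
  α = a ⨾ b

  m : ℕ
  m = n + varBound α

  ρ₁ σ₂ : Var → Var
  ρ₁ = ρ-left b ρ n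
  σ₂ = σ-right a σ ρ₁

  n≤m : n ≤ m
  n≤m = m≤m+n n (varBound α)

  ρ₁< : ∀ x → O α x ≡ true → ρ₁ x < m
  ρ₁< x p with if-cases (O b x) (n + x) (ρ x)
  ... | inj₁ (_ , e) rewrite e = +-monoʳ-< n (vars<varBound α x (O⊆vars α x p))
  ... | inj₂ (_ , e) rewrite e = <-≤-trans (ρ< x p) n≤m

  ρ₁≢σ : ∀ x w → O α x ≡ true → vars α w ≡ true → ρ₁ x ≢ σ w
  ρ₁≢σ x w ox vw e with if-cases (O b x) (n + x) (ρ x)
  ... | inj₁ (_ , e′) = m+n≮m n x (subst (_< n) (trans (sym e) e′) (σ< w vw))
  ... | inj₂ (_ , e′) = ρ≢σ x w ox vw (trans (sym e′) e)

  ρ₁-inj : ∀ x y → O a x ≡ true → O a y ≡ true → ρ₁ x ≡ ρ₁ y → x ≡ y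
  ρ₁-inj x y ox oy e with if-cases (O b x) (n + x) (ρ x) | if-cases (O b y) (n + y) (ρ y)
  ... | inj₁ (_ , ex) | inj₁ (_ , ey) = +-cancelˡ-≡ n x y (trans (sym ex) (trans e ey))
  ... | inj₁ (_ , ex) | inj₂ (_ , ey) =
    ⊥-elim (m+n≮m n x (subst (_< n) (trans (sym ey) (trans (sym e) ex)) (ρ< y (∨-trueˡ _ oy))))
  ... | inj₂ (_ , ex) | inj₁ (_ , ey) =
    ⊥-elim (m+n≮m n y (subst (_< n) (trans (sym ex) (trans e ey)) (ρ< x (∨-trueˡ _ ox))))
  ... | inj₂ (_ , ex) | inj₂ (_ , ey) = ρ-inj x y (∨-trueˡ _ ox) (∨-trueˡ _ oy) (trans (sym ex) (trans e ey))

  admissible₁ : Admissible a σ ρ₁ m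
  admissible₁ = record
    { σ<    = λ z p → <-≤-trans (σ< z (∨-trueˡ _ p)) n≤m
    ; ρ<    = λ x p → ρ₁< x (∨-trueˡ _ p)
    ; ρ-inj = ρ₁-inj
    ; ρ≢σ   = λ x z ox vz → ρ₁≢σ x z (∨-trueˡ _ ox) (∨-trueˡ _ vz) }

  σ₂< : ∀ z → vars b z ≡ true → σ₂ z < m
  σ₂< z p with if-cases (O a z) (ρ₁ z) (σ z)
  ... | inj₁ (oz , e) rewrite e = ρ₁< z (∨-trueˡ _ oz)
  ... | inj₂ (_ , e)  rewrite e = <-≤-trans (σ< z (∨-trueʳ (vars a z) p)) n≤m

  ρ≢σ₂ : ∀ x z → O b x ≡ true → vars b z ≡ true → ρ x ≢ σ₂ z
  ρ≢σ₂ x z ox vz e with if-cases (O a z) (ρ₁ z) (σ z)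
  ... | inj₂ (_ , e′) = ρ≢σ x z (∨-trueʳ (O a x) ox) (∨-trueʳ (vars a z) vz) (trans e e′)
  ... | inj₁ (oz , e′) with if-cases (O b z) (n + z) (ρ z)
  ...   | inj₁ (_ , e″) = m+n≮m n z (subst (_< n) (trans e (trans e′ e″)) (ρ< x (∨-trueʳ (O a x) ox)))
  ...   | inj₂ (obz , e″) with ρ-inj x z (∨-trueʳ (O a x) ox) (∨-trueˡ _ oz) (trans e (trans e′ e″))
  ...     | refl = true≢false ox obz

  admissible₂ : Admissible b σ₂ ρ m
  admissible₂ = record
    { σ<    = σ₂<
    ; ρ<    = λ x p → <-≤-trans (ρ< x (∨-trueʳ (O a x) p)) n≤m
    ; ρ-inj = λ x y ox oy → ρ-inj x y (∨-trueʳ (O a x) ox) (∨-trueʳ (O a y) oy)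
    ; ρ≢σ   = ρ≢σ₂ }

  module _ {β₁ β₂ : Expr S} (t₁ : Translation a σ ρ₁ m β₁) (t₂ : Translation b σ₂ ρ m β₂) where
    private
      module T₁ = Translation t₁
      module T₂ = Translation t₂

    O₁-σ : ∀ w → vars α w ≡ true → O β₁ (σ w) ≡ false
    O₁-σ w vw = O-outside t₁ (σ w) (<-≤-trans (σ< w vw) n≤m) (λ x ox e → ρ₁≢σ x w (∨-trueˡ _ ox) vw e)

    O₂-ρ : ∀ x → O α x ≡ true → O b x ≡ false → O β₂ (ρ x) ≡ false
    O₂-ρ x ox obx = O-outside t₂ (ρ x) (<-≤-trans (ρ< x ox) n≤m) ρx′≢ρx
      where
      ρx′≢ρx : ∀ x′ → O b x′ ≡ true → ρ x′ ≢ ρ x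
      ρx′≢ρx x′ ox′ e with ρ-inj x′ x (∨-trueʳ (O a x′) ox′) ox e
      ... | refl = true≢false ox′ obx

    I-sound : ∀ z → I (β₁ ⨾ β₂) z ≡ true → ∃ λ w → I α w ≡ true × σ w ≡ z
    I-sound z p with ∨-true⁻ (I β₁ z) _ p
    ... | inj₁ q = let (w , iw , e) = T₁.I-sound z q in w , ∨-trueˡ _ iw , e
    ... | inj₂ q with ∧-true⁻ _ _ q
    ...   | (i₂ , no) with T₂.I-sound z i₂
    ...     | (w , iw , e) with if-cases (O a w) (ρ₁ w) (σ w)
    ...       | inj₁ (ow , e′) = ⊥-elim (true≢false
                  (subst (λ u → O β₁ u ≡ true) (trans (sym e′) e) (T₁.O-complete w ow)) (not-true⁻ _ no))
    ...       | inj₂ (ow , e′) = w , ∨-trueʳ (I a w) (∧-true iw (not-true ow)) , trans (sym e′) e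

    I-complete : ∀ w → I α w ≡ true → I (β₁ ⨾ β₂) (σ w) ≡ true
    I-complete w p with ∨-true⁻ (I a w) _ p
    ... | inj₁ q = ∨-trueˡ _ (T₁.I-complete w q)
    ... | inj₂ q with ∧-true⁻ _ _ q
    ...   | (iw , no) = ∨-trueʳ (I β₁ (σ w))
            (∧-true (subst (λ u → I β₂ u ≡ true) (if-false (not-true⁻ _ no)) (T₂.I-complete w iw))
                    (not-true (O₁-σ w (I⊆vars α w p))))

    O-complete : ∀ x → O α x ≡ true → O (β₁ ⨾ β₂) (ρ x) ≡ true
    O-complete x p with if-cases (O b x) (n + x) (ρ x)
    ... | inj₁ (ob , _) = ∨-trueʳ (O β₁ (ρ x)) (T₂.O-complete x ob)
    ... | inj₂ (ob , e) with ∨-true⁻ (O a x) _ p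
    ...   | inj₁ oa  = ∨-trueˡ _ (subst (λ u → O β₁ u ≡ true) e (T₁.O-complete x oa))
    ...   | inj₂ ob′ = ⊥-elim (true≢false ob′ ob)

    O-sound : ∀ y → O (β₁ ⨾ β₂) y ≡ true → (∃ λ x → O α x ≡ true × ρ x ≡ y) ⊎ (n ≤ y)
    O-sound y p with ∨-true⁻ (O β₁ y) _ p
    ... | inj₂ q with T₂.O-sound y q
    ...   | inj₁ (x , ox , e) = inj₁ (x , ∨-trueʳ (O a x) ox , e)
    ...   | inj₂ le = inj₂ (≤-trans n≤m le)
    O-sound y p | inj₁ q with T₁.O-sound y q
    ...   | inj₂ le = inj₂ (≤-trans n≤m le)
    ...   | inj₁ (x , ox , e) with if-cases (O b x) (n + x) (ρ x)
    ...     | inj₁ (_ , e′) = inj₂ (subst (n ≤_) (trans (sym e′) e) (m≤m+n n x))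
    ...     | inj₂ (_ , e′) = inj₁ (x , ∨-trueˡ _ ox , trans (sym e′) e)

    module _ (D : Instance S) (ν₁ μ₁ : Valuation) (hv : Agree (vars α) σ ν₁ μ₁) where

      agree₁ : Agree (vars a) σ ν₁ μ₁
      agree₁ z p = hv z (∨-trueˡ _ p)

      agree₂ : ∀ ν μ → ⟦ a ⟧ D ν₁ ν → ⟦ β₁ ⟧ D μ₁ μ → Agree (O a) ρ₁ ν μ → Agree (vars b) σ₂ ν μ
      agree₂ ν μ h₁ g₁ c₁ z p with if-cases (O a z) (ρ₁ z) (σ z)
      ... | inj₁ (oz , e) rewrite e = c₁ z oz
      ... | inj₂ (oz , e) rewrite e =
        trans (sym (⟦⟧-frame a D ν₁ ν h₁ z oz))
              (trans (hv z vz) (⟦⟧-frame β₁ D μ₁ μ g₁ (σ z) (O₁-σ z vz)))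
        where
        vz : vars α z ≡ true
        vz = ∨-trueʳ (vars a z) p

      agree-out : ∀ ν μ ν₂ μ₂ → ⟦ b ⟧ D ν ν₂ → ⟦ β₂ ⟧ D μ μ₂ → Agree (O a) ρ₁ ν μ → Agree (O b) ρ ν₂ μ₂ →
        Agree (O α) ρ ν₂ μ₂
      agree-out ν μ ν₂ μ₂ h₂ g₂ c₁ c₂ x p with if-cases (O b x) (n + x) (ρ x)
      ... | inj₁ (ob , _) = c₂ x ob
      ... | inj₂ (ob , e) with ∨-true⁻ (O a x) _ p
      ...   | inj₂ ob′ = ⊥-elim (true≢false ob′ ob)
      ...   | inj₁ oa  = begin
        ν₂ x       ≡⟨ ⟦⟧-frame b D ν ν₂ h₂ x ob ⟨
        ν x        ≡⟨ c₁ x oa ⟩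
        μ (ρ₁ x)   ≡⟨ cong μ e ⟩
        μ (ρ x)    ≡⟨ ⟦⟧-frame β₂ D μ μ₂ g₂ (ρ x) (O₂-ρ x p ob) ⟩
        μ₂ (ρ x)   ∎
        where open ≡-Reasoning

      forward : Forward D α (β₁ ⨾ β₂) (O α) ρ ν₁ μ₁
      forward ν₂ (ν , h₁ , h₂) with proj₁ (T₁.simulates D ν₁ μ₁ agree₁) ν h₁
      ... | μ , g₁ , c₁ with proj₁ (T₂.simulates D ν μ (agree₂ ν μ h₁ g₁ c₁)) ν₂ h₂
      ...   | μ₂ , g₂ , c₂ = μ₂ , (μ , g₁ , g₂) , agree-out ν μ ν₂ μ₂ h₂ g₂ c₁ c₂

      backward : Backward D α (β₁ ⨾ β₂) (O α) ρ ν₁ μ₁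
      backward μ₂ (μ , g₁ , g₂) with proj₂ (T₁.simulates D ν₁ μ₁ agree₁) μ g₁
      ... | ν , h₁ , c₁ with proj₂ (T₂.simulates D ν μ (agree₂ ν μ h₁ g₁ c₁)) μ₂ g₂
      ...   | ν₂ , h₂ , c₂ = ν₂ , (ν , h₁ , h₂) , agree-out ν μ ν₂ μ₂ h₂ g₂ c₁ c₂

    translation : Translation α σ ρ n (β₁ ⨾ β₂)
    translation = record
      { io-disjoint = node-io-disjoint adm (β₁ ⨾ β₂) I-sound O-sound , T₁.io-disjoint , T₂.io-disjoint
      ; I-sound     = I-sound
      ; I-complete  = I-complete
      ; O-complete  = O-complete
      ; O-sound     = O-sound
      ; simulates   = λ D ν₁ μ₁ hv → forward D ν₁ μ₁ hv , backward D ν₁ μ₁ hv }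

module _ {S : Schema} where

  missing : Expr S → Expr S → List Var
  missing e f = filterᵇ (λ x → not (O e x)) (outputs f)

  padding : Expr S → Expr S → (Var → Var) → (Var → Var) → List Var → List Assignment
  padding e f σ ρ aux = assignments ρ (λ x → inj₁ (σ x)) (missing e f) ++ zeroAll aux

  elemᵇ-missing⁻ : ∀ e f x → elemᵇ x (missing e f) ≡ true → O f x ≡ true × O e x ≡ false
  elemᵇ-missing⁻ e f x p =
    let (xf , ¬xe) = elemᵇ-filterᵇ⁻ _ x (outputs f) p in trans (O≡elemᵇ-outputs f x) xf , not-true⁻ _ ¬xe

  elemᵇ-missing⁺ : ∀ e f x → O f x ≡ true → O e x ≡ false → elemᵇ x (missing e f) ≡ true
  elemᵇ-missing⁺ e f x xf ¬xe = elemᵇ-filterᵇ⁺ _ x (outputs f) (trans (sym (O≡elemᵇ-outputs f x)) xf) (not-true ¬xe)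

module Branch {S : Schema} (e f : Expr S) (σ ρ : Var → Var) (n : ℕ) (aux : List Var)
  (adm : Admissible (e ∪ₑ f) σ ρ n) {β : Expr S} (t : Translation e σ ρ n β)
  (aux≥n : ∀ y → elemᵇ y aux ≡ true → n ≤ y) (aux⊇ : ∀ y → O β y ≡ true → n ≤ y → elemᵇ y aux ≡ true) where
  open Admissible adm
  private
    module T = Translation t

  α : Expr S
  α = e ∪ₑ f

  copies pad : List Assignment
  copies = assignments ρ (λ x → inj₁ (σ x)) (missing e f)
  pad    = padding e f σ ρ aux

  β′ : Expr S
  β′ = thenAssign β pad

  targets-pad⁻ : ∀ z → targets pad z ≡ true →
    (∃ λ x → (O f x ≡ true × O e x ≡ false) × ρ x ≡ z) ⊎ elemᵇ z aux ≡ true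
  targets-pad⁻ z p with ∨-true⁻ (targets copies z) _ (trans (sym (targets-++ copies (zeroAll aux) z)) p)
  ... | inj₁ q = let (x , m , ρx≡z) = targets-assignments⁻ ρ _ (missing e f) z q in
                 inj₁ (x , elemᵇ-missing⁻ e f x m , ρx≡z)
  ... | inj₂ q = let (x , m , x≡z) = targets-assignments⁻ (λ t → t) _ aux z q in
                 inj₂ (subst (λ u → elemᵇ u aux ≡ true) x≡z m)

  sources-pad⁻ : ∀ z → sources pad z ≡ true → ∃ λ x → (O f x ≡ true × O e x ≡ false) × σ x ≡ z
  sources-pad⁻ z p with ∨-true⁻ (sources copies z) _ (trans (sym (sources-++ copies (zeroAll aux) z)) p)
  ... | inj₁ q = let (x , m , s) = sources-assignments⁻ ρ _ (missing e f) z q in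
                 x , elemᵇ-missing⁻ e f x m , sym (≡ᵇ-true⁻ _ _ s)
  ... | inj₂ q = ⊥-elim (true≢false q (sources-constants (λ t → t) (λ _ → 0) aux z))

  σ∉targets : ∀ w → vars α w ≡ true → targets pad (σ w) ≡ false
  σ∉targets w vw = ¬true⇒false λ q → [ (λ { (x , (xf , _) , eq) → ρ≢σ x w (∨-trueʳ (O e x) xf) vw eq })
                                      , (λ m → <⇒≱ (σ< w vw) (aux≥n _ m)) ] (targets-pad⁻ (σ w) q)

  targets∉sources : ∀ z → targets pad z ≡ true → sources pad z ≡ false
  targets∉sources z p = ¬true⇒false λ q → let (x , (xf , _) , σx≡z) = sources-pad⁻ z q in
    true≢false (subst (λ u → targets pad u ≡ true) (sym σx≡z) p)
               (σ∉targets x (O⊆vars α x (∨-trueʳ (O e x) xf)))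

  targets∉I : ∀ z → targets pad z ≡ true → I β z ≡ false
  targets∉I z p = ¬true⇒false λ q → let (w , iw , σw≡z) = T.I-sound z q in
    true≢false (subst (λ u → targets pad u ≡ true) (sym σw≡z) p) (σ∉targets w (∨-trueˡ _ (I⊆vars e w iw)))

  O-σ : ∀ w → vars α w ≡ true → O β (σ w) ≡ false
  O-σ w vw = O-outside t (σ w) (σ< w vw) (λ x ox eq → ρ≢σ x w (∨-trueˡ _ ox) vw eq)

  ρ∈targets : ∀ x → O f x ≡ true → O e x ≡ false → targets pad (ρ x) ≡ true
  ρ∈targets x xf ¬xe = trans (targets-++ copies (zeroAll aux) (ρ x))
    (∨-trueˡ _ (targets-assignments⁺ ρ _ (missing e f) x (elemᵇ-missing⁺ e f x xf ¬xe)))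

  ρ∉targets : ∀ x → O e x ≡ true → targets pad (ρ x) ≡ false
  ρ∉targets x xe = ¬true⇒false λ q → [ ρx′≢ρx , (λ m → <⇒≱ (ρ< x (∨-trueˡ _ xe)) (aux≥n _ m)) ] (targets-pad⁻ (ρ x) q)
    where
    ρx′≢ρx : ¬ ∃ λ x′ → (O f x′ ≡ true × O e x′ ≡ false) × ρ x′ ≡ ρ x
    ρx′≢ρx (x′ , (x′f , ¬x′e) , eq) with ρ-inj x′ x (∨-trueʳ (O e x′) x′f) (∨-trueˡ _ xe) eq
    ... | refl = true≢false xe ¬x′e

  io-disjoint : IODisjoint β′
  io-disjoint = io-disjoint-thenAssign β pad T.io-disjoint targets∉I targets∉sources

  I-sound : ∀ z → I β′ z ≡ true → ∃ λ w → I α w ≡ true × σ w ≡ z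
  I-sound z p with I-thenAssign⁻ β pad z p
  ... | inj₁ q = let (w , iw , eq) = T.I-sound z q in w , ∨-trueˡ _ iw , eq
  ... | inj₂ (q , _) = let (x , (xf , ¬xe) , eq) = sources-pad⁻ z q in
        x , ∨-trueʳ (I e x) (∨-trueʳ (I f x) (xor-trueʳ ¬xe xf)) , eq

  I-complete : ∀ w → I e w ≡ true → I β′ (σ w) ≡ true
  I-complete w p = I-thenAssign⁺ˡ β pad (σ w) (T.I-complete w p)

  I-complete-missing : ∀ w → O f w ≡ true → O e w ≡ false → I β′ (σ w) ≡ true
  I-complete-missing w wf ¬we = I-thenAssign⁺ʳ β pad (σ w)
    (trans (sources-++ copies (zeroAll aux) (σ w))
           (∨-trueˡ _ (sources-assignments⁺ ρ _ (missing e f) w (σ w) (elemᵇ-missing⁺ e f w wf ¬we) (≡ᵇ-refl (σ w)))))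
    (O-σ w vw) (σ∉targets w vw)
    where
    vw : vars α w ≡ true
    vw = O⊆vars α w (∨-trueʳ (O e w) wf)

  O-sound : ∀ y → O β′ y ≡ true → (∃ λ x → O α x ≡ true × ρ x ≡ y) ⊎ elemᵇ y aux ≡ true
  O-sound y p with ∨-true⁻ (O β y) _ (trans (sym (O-thenAssign β pad y)) p)
  ... | inj₂ q with targets-pad⁻ y q
  ...   | inj₁ (x , (xf , _) , eq) = inj₁ (x , ∨-trueʳ (O e x) xf , eq)
  ...   | inj₂ m = inj₂ m
  O-sound y p | inj₁ q with T.O-sound y q
  ...   | inj₁ (x , ox , eq) = inj₁ (x , ∨-trueˡ _ ox , eq)
  ...   | inj₂ le = inj₂ (aux⊇ y q le)

  O-complete : ∀ x → O α x ≡ true → O β′ (ρ x) ≡ true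
  O-complete x ox with bool-cases (O e x) | ∨-true⁻ (O e x) _ ox
  ... | inj₁ xe  | _        = trans (O-thenAssign β pad (ρ x)) (∨-trueˡ _ (T.O-complete x xe))
  ... | inj₂ ¬xe | inj₁ xe  = ⊥-elim (true≢false xe ¬xe)
  ... | inj₂ ¬xe | inj₂ xf  = trans (O-thenAssign β pad (ρ x)) (∨-trueʳ (O β (ρ x)) (ρ∈targets x xf ¬xe))

  O-complete-aux : ∀ y → elemᵇ y aux ≡ true → O β′ y ≡ true
  O-complete-aux y p = trans (O-thenAssign β pad y) (∨-trueʳ (O β y)
    (trans (targets-++ copies (zeroAll aux) y) (∨-trueʳ (targets copies y) (targets-assignments⁺ (λ t → t) _ aux y p))))

  module _ (D : Instance S) (ν₁ μ₁ : Valuation) (hv : Agree (vars α) σ ν₁ μ₁) where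

    -- An output of f missing from e keeps its input value in e; the padding copies it.
    agree-out : ∀ ν₂ μ → ⟦ e ⟧ D ν₁ ν₂ → ⟦ β ⟧ D μ₁ μ → Agree (O e) ρ ν₂ μ → Agree (O α) ρ ν₂ (run pad μ)
    agree-out ν₂ μ h g c x ox with bool-cases (O e x)
    ... | inj₁ xe  = trans (c x xe) (sym (run-untouched pad μ (ρ x) (ρ∉targets x xe)))
    ... | inj₂ ¬xe = begin
      ν₂ x                ≡⟨ ⟦⟧-frame e D ν₁ ν₂ h x ¬xe ⟨
      ν₁ x                ≡⟨ hv x vx ⟩
      μ₁ (σ x)            ≡⟨ ⟦⟧-frame β D μ₁ μ g (σ x) (O-σ x vx) ⟩
      μ (σ x)             ≡⟨ run-assigned pad μ (ρ x) (μ (σ x)) ρx∈targets copies-σx targets∉sources ⟨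
      run pad μ (ρ x)     ∎
      where
      open ≡-Reasoning
      vx : vars α x ≡ true
      vx = O⊆vars α x ox
      xf : O f x ≡ true
      xf = [ (λ xe → ⊥-elim (true≢false xe ¬xe)) , (λ xf → xf) ] (∨-true⁻ (O e x) _ ox)
      ρx∈targets : targets pad (ρ x) ≡ true
      ρx∈targets = ρ∈targets x xf ¬xe
      copies-σx : ∀ s → Assigns (ρ x) s pad → eval μ s ≡ μ (σ x)
      copies-σx s pr with Assigns-++⁻ (ρ x) s copies (zeroAll aux) pr
      ... | inj₁ pc with Assigns-assignments⁻ ρ _ (missing e f) (ρ x) s pc
      ...   | x′ , m , ρx′≡ρx , refl with ρ-inj x′ x (∨-trueʳ (O e x′) (proj₁ (elemᵇ-missing⁻ e f x′ m))) ox ρx′≡ρx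
      ...     | refl = refl
      copies-σx s pr | inj₂ pz =
        let (y , m , y≡ρx , _) = Assigns-assignments⁻ (λ t → t) _ aux (ρ x) s pz in
        ⊥-elim (<⇒≱ (ρ< x ox) (aux≥n (ρ x) (subst (λ u → elemᵇ u aux ≡ true) y≡ρx m)))

    agreeₑ : Agree (vars e) σ ν₁ μ₁
    agreeₑ z p = hv z (∨-trueˡ _ p)

    forward : Forward D e β′ (O α) ρ ν₁ μ₁
    forward ν₂ h with proj₁ (T.simulates D ν₁ μ₁ agreeₑ) ν₂ h
    ... | μ , g , c = run pad μ , ⟦thenAssign⟧⁺ β pad D μ₁ μ g , agree-out ν₂ μ h g c

    backward : Backward D e β′ (O α) ρ ν₁ μ₁
    backward μ₂ g′ with ⟦thenAssign⟧⁻ β pad D μ₁ μ₂ g′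
    ... | μ , g , μ₂≐ with proj₂ (T.simulates D ν₁ μ₁ agreeₑ) μ g
    ...   | ν₂ , h , c = ν₂ , h , λ x ox → trans (agree-out ν₂ μ h g c x ox) (sym (μ₂≐ (ρ x)))

module _ {S : Schema} where

  auxOutputs : ℕ → Expr S → Expr S → List Var
  auxOutputs n β₁ β₂ = filterᵇ (n ≤ᵇ_) (outputs β₁ ++ outputs β₂)

  unionTranslation : Expr S → Expr S → (Var → Var) → (Var → Var) → ℕ → Expr S → Expr S → Expr S
  unionTranslation a b σ ρ n β₁ β₂ =
    thenAssign β₁ (padding a b σ ρ aux) ∪ₑ thenAssign β₂ (padding b a σ ρ aux)
    where
    aux : List Var
    aux = auxOutputs n β₁ β₂

  I-∪-comm : ∀ (a b : Expr S) z → I (b ∪ₑ a) z ≡ I (a ∪ₑ b) z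
  I-∪-comm a b z = ∨-∨-xor-swap (I b z) (I a z) (O b z) (O a z)

module Union {S : Schema} (a b : Expr S) (σ ρ : Var → Var) (n : ℕ) (adm : Admissible (a ∪ₑ b) σ ρ n) where
  open Admissible adm

  α : Expr S
  α = a ∪ₑ b

  admissible₁ : Admissible a σ ρ n
  admissible₁ = record
    { σ<    = λ z p → σ< z (∨-trueˡ _ p)
    ; ρ<    = λ x p → ρ< x (∨-trueˡ _ p)
    ; ρ-inj = λ x y p q → ρ-inj x y (∨-trueˡ _ p) (∨-trueˡ _ q)
    ; ρ≢σ   = λ x z p q → ρ≢σ x z (∨-trueˡ _ p) (∨-trueˡ _ q) }

  admissible₂ : Admissible b σ ρ n
  admissible₂ = record
    { σ<    = λ z p → σ< z (∨-trueʳ (vars a z) p)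
    ; ρ<    = λ x p → ρ< x (∨-trueʳ (O a x) p)
    ; ρ-inj = λ x y p q → ρ-inj x y (∨-trueʳ (O a x) p) (∨-trueʳ (O a y) q)
    ; ρ≢σ   = λ x z p q → ρ≢σ x z (∨-trueʳ (O a x) p) (∨-trueʳ (vars a z) q) }

  vars-swap : ∀ z → vars (b ∪ₑ a) z ≡ vars α z
  vars-swap z = ∨-comm (vars b z) (vars a z)

  O-swap : ∀ z → O (b ∪ₑ a) z ≡ O α z
  O-swap z = ∨-comm (O b z) (O a z)

  admissible-swap : Admissible (b ∪ₑ a) σ ρ n
  admissible-swap = record
    { σ<    = λ z p → σ< z (trans (sym (vars-swap z)) p)
    ; ρ<    = λ x p → ρ< x (trans (sym (O-swap x)) p)
    ; ρ-inj = λ x y p q → ρ-inj x y (trans (sym (O-swap x)) p) (trans (sym (O-swap y)) q)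
    ; ρ≢σ   = λ x z p q → ρ≢σ x z (trans (sym (O-swap x)) p) (trans (sym (vars-swap z)) q) }

  module _ {β₁ β₂ : Expr S} (t₁ : Translation a σ ρ n β₁) (t₂ : Translation b σ ρ n β₂) where

    aux : List Var
    aux = auxOutputs n β₁ β₂

    aux≥n : ∀ y → elemᵇ y aux ≡ true → n ≤ y
    aux≥n y p = ≤ᵇ-true⁻ n y (proj₂ (elemᵇ-filterᵇ⁻ (n ≤ᵇ_) y (outputs β₁ ++ outputs β₂) p))

    aux⊇ : ∀ y → elemᵇ y (outputs β₁) ∨ elemᵇ y (outputs β₂) ≡ true → n ≤ y → elemᵇ y aux ≡ true
    aux⊇ y p n≤y = elemᵇ-filterᵇ⁺ (n ≤ᵇ_) y (outputs β₁ ++ outputs β₂)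
      (trans (elemᵇ-++ y (outputs β₁) (outputs β₂)) p) (≤⇒≤ᵇ-true n≤y)

    module B₁ = Branch a b σ ρ n aux adm t₁ aux≥n
      (λ y p → aux⊇ y (∨-trueˡ _ (trans (sym (O≡elemᵇ-outputs β₁ y)) p)))
    module B₂ = Branch b a σ ρ n aux admissible-swap t₂ aux≥n
      (λ y p → aux⊇ y (∨-trueʳ (elemᵇ y (outputs β₁)) (trans (sym (O≡elemᵇ-outputs β₂ y)) p)))

    β : Expr S
    β = unionTranslation a b σ ρ n β₁ β₂

    O₁⊆O₂ : ∀ z → O B₁.β′ z ≡ true → O B₂.β′ z ≡ true
    O₁⊆O₂ z p with B₁.O-sound z p
    ... | inj₁ (x , ox , eq) = subst (λ u → O B₂.β′ u ≡ true) eq (B₂.O-complete x (trans (O-swap x) ox))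
    ... | inj₂ m = B₂.O-complete-aux z m

    O₂⊆O₁ : ∀ z → O B₂.β′ z ≡ true → O B₁.β′ z ≡ true
    O₂⊆O₁ z p with B₂.O-sound z p
    ... | inj₁ (x , ox , eq) = subst (λ u → O B₁.β′ u ≡ true) eq (B₁.O-complete x (trans (sym (O-swap x)) ox))
    ... | inj₂ m = B₁.O-complete-aux z m

    I-sound : ∀ z → I β z ≡ true → ∃ λ w → I α w ≡ true × σ w ≡ z
    I-sound z p with ∨-true⁻ (I B₁.β′ z) _ p
    ... | inj₁ q = B₁.I-sound z q
    ... | inj₂ q with ∨-true⁻ (I B₂.β′ z) _ q
    ...   | inj₁ r = let (w , iw , eq) = B₂.I-sound z r in w , trans (sym (I-∪-comm a b w)) iw , eq
    ...   | inj₂ r = ⊥-elim (true≢false r (xor-≡⇒false (⇔true⇒≡ (O₁⊆O₂ z) (O₂⊆O₁ z))))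

    I-complete : ∀ w → I α w ≡ true → I β (σ w) ≡ true
    I-complete w p with ∨-true⁻ (I a w) _ p
    ... | inj₁ q = ∨-trueˡ _ (B₁.I-complete w q)
    ... | inj₂ q with ∨-true⁻ (I b w) _ q
    ...   | inj₁ r = ∨-trueʳ (I B₁.β′ (σ w)) (∨-trueˡ _ (B₂.I-complete w r))
    ...   | inj₂ r with xor-true⁻ (O a w) (O b w) r
    ...     | inj₁ (wa , ¬wb) = ∨-trueʳ (I B₁.β′ (σ w)) (∨-trueˡ _ (B₂.I-complete-missing w wa ¬wb))
    ...     | inj₂ (¬wa , wb) = ∨-trueˡ _ (B₁.I-complete-missing w wb ¬wa)

    O-sound : ∀ y → O β y ≡ true → (∃ λ x → O α x ≡ true × ρ x ≡ y) ⊎ (n ≤ y)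
    O-sound y p with ∨-true⁻ (O B₁.β′ y) _ p
    ... | inj₁ q = [ inj₁ , inj₂ ∘ aux≥n y ] (B₁.O-sound y q)
    ... | inj₂ q with B₂.O-sound y q
    ...   | inj₁ (x , ox , eq) = inj₁ (x , trans (sym (O-swap x)) ox , eq)
    ...   | inj₂ m = inj₂ (aux≥n y m)

    simulates : ∀ D → Simulates D α β σ ρ
    simulates D ν₁ μ₁ hv = forward , backward
      where
      hv-swap : Agree (vars (b ∪ₑ a)) σ ν₁ μ₁
      hv-swap z p = hv z (trans (sym (vars-swap z)) p)
      forward : Forward D α β (O α) ρ ν₁ μ₁
      forward ν₂ (inj₁ h) = let (μ₂ , g , c) = B₁.forward D ν₁ μ₁ hv ν₂ h in μ₂ , inj₁ g , c
      forward ν₂ (inj₂ h) = let (μ₂ , g , c) = B₂.forward D ν₁ μ₁ hv-swap ν₂ h in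
        μ₂ , inj₂ g , λ x ox → c x (trans (O-swap x) ox)
      backward : Backward D α β (O α) ρ ν₁ μ₁
      backward μ₂ (inj₁ g) = let (ν₂ , h , c) = B₁.backward D ν₁ μ₁ hv μ₂ g in ν₂ , inj₁ h , c
      backward μ₂ (inj₂ g) = let (ν₂ , h , c) = B₂.backward D ν₁ μ₁ hv-swap μ₂ g in
        ν₂ , inj₂ h , λ x ox → c x (trans (O-swap x) ox)

    translation : Translation α σ ρ n β
    translation = record
      { io-disjoint = node-io-disjoint adm β I-sound O-sound , B₁.io-disjoint , B₂.io-disjoint
      ; I-sound     = I-sound
      ; I-complete  = I-complete
      ; O-complete  = λ x p → ∨-trueˡ _ (B₁.O-complete x p)
      ; O-sound     = O-sound
      ; simulates   = simulates }

module _ {S : Schema} where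

  -- The translation of b writes each output x to n + x, which is compared with
  -- the value of x after a (at ρ x if a outputs x, at σ x otherwise); outputs of
  -- a that b does not write must have kept their input value.
  diffTests : Expr S → Expr S → (Var → Var) → (Var → Var) → ℕ → List Test
  diffTests a b σ ρ n = tests (n +_) (σ-right a σ ρ) (outputs b) ++ tests ρ σ (missing b a)

  -- Zeroing the outputs of β₂ after β₁ gives both operands of the difference
  -- the same outputs; since γ resets them again, β₁′ ⨾ γ relates exactly the
  -- pairs of β₁′ that pass the tests.
  diffTranslation : Expr S → Expr S → (Var → Var) → (Var → Var) → ℕ → Expr S → Expr S → Expr S
  diffTranslation a b σ ρ n β₁ β₂ = β₁′ −ₑ (β₁′ ⨾ γ)
    where
    zeros : List Assignment
    zeros = zeroAll (outputs β₂)
    β₁′ γ : Expr S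
    β₁′ = thenAssign β₁ zeros
    γ   = thenAssign (thenTest β₂ (diffTests a b σ ρ n)) zeros

module Difference {S : Schema} (a b : Expr S) (σ ρ : Var → Var) (n : ℕ) (adm : Admissible (a −ₑ b) σ ρ n) where
  open Admissible adm

  α : Expr S
  α = a −ₑ b

  m : ℕ
  m = n + varBound α

  n≤m : n ≤ m
  n≤m = m≤m+n n (varBound α)

  admissible₁ : Admissible a σ ρ m
  admissible₁ = record
    { σ<    = λ z p → <-≤-trans (σ< z (∨-trueˡ _ p)) n≤m
    ; ρ<    = λ x p → <-≤-trans (ρ< x p) n≤m
    ; ρ-inj = ρ-inj
    ; ρ≢σ   = λ x z p q → ρ≢σ x z p (∨-trueˡ _ q) }

  admissible₂ : Admissible b σ (n +_) m
  admissible₂ = record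
    { σ<    = λ z p → <-≤-trans (σ< z (∨-trueʳ (vars a z) p)) n≤m
    ; ρ<    = λ x p → +-monoʳ-< n (vars<varBound α x (∨-trueʳ (vars a x) (O⊆vars b x p)))
    ; ρ-inj = λ x y _ _ → +-cancelˡ-≡ n x y
    ; ρ≢σ   = λ x z _ q e → <⇒≱ (σ< z (∨-trueʳ (vars a z) q)) (subst (n ≤_) e (m≤m+n n x)) }

  module _ {β₁ β₂ : Expr S} (t₁ : Translation a σ ρ m β₁) (t₂ : Translation b σ (n +_) m β₂) where
    private
      module T₁ = Translation t₁
      module T₂ = Translation t₂

    after : Var → Var
    after = σ-right a σ ρ

    zeros : List Assignment
    zeros = zeroAll (outputs β₂)

    ts : List Test
    ts = diffTests a b σ ρ n

    β₁′ γ check β : Expr S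
    β₁′   = thenAssign β₁ zeros
    γ     = thenAssign (thenTest β₂ ts) zeros
    check = β₁′ ⨾ γ
    β     = diffTranslation a b σ ρ n β₁ β₂

    targets-zeros : ∀ z → targets zeros z ≡ O β₂ z
    targets-zeros z = trans (targets-zeroAll (outputs β₂) z) (sym (O≡elemᵇ-outputs β₂ z))

    sources-zeros : ∀ z → sources zeros z ≡ false
    sources-zeros = sources-constants (λ t → t) (λ _ → 0) (outputs β₂)

    O-β₁′ : ∀ z → O β₁′ z ≡ O β₁ z ∨ O β₂ z
    O-β₁′ z = trans (O-thenAssign β₁ zeros z) (cong (O β₁ z ∨_) (targets-zeros z))

    O-β₁′⁺ : ∀ z → O β₁ z ∨ O β₂ z ≡ true → O β₁′ z ≡ true
    O-β₁′⁺ z p = trans (O-β₁′ z) p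

    O-γ : ∀ z → O γ z ≡ O β₂ z ∨ O β₂ z
    O-γ z = trans (O-thenAssign (thenTest β₂ ts) zeros z) (cong₂ _∨_ (O-thenTest β₂ ts z) (targets-zeros z))

    O-γ⁻ : ∀ z → O γ z ≡ true → O β₂ z ≡ true
    O-γ⁻ z p = [ (λ q → q) , (λ q → q) ] (∨-true⁻ (O β₂ z) _ (trans (sym (O-γ z)) p))

    O₂≥n : ∀ y → O β₂ y ≡ true → n ≤ y
    O₂≥n y p with T₂.O-sound y p
    ... | inj₁ (x , _ , e) = subst (n ≤_) e (m≤m+n n x)
    ... | inj₂ le = ≤-trans n≤m le

    O₂<n : ∀ y → y < n → O β₂ y ≡ false
    O₂<n y y<n = ¬true⇒false λ p → <⇒≱ y<n (O₂≥n y p)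

    O₁′-σ : ∀ w → vars α w ≡ true → O β₁′ (σ w) ≡ false
    O₁′-σ w vw = trans (O-β₁′ (σ w)) (∨-false
      (O-outside t₁ (σ w) (<-≤-trans (σ< w vw) n≤m) (λ x ox e → ρ≢σ x w ox vw e)) (O₂<n (σ w) (σ< w vw)))

    O-sound : ∀ y → O β y ≡ true → (∃ λ x → O α x ≡ true × ρ x ≡ y) ⊎ (n ≤ y)
    O-sound y p with ∨-true⁻ (O β₁ y) _ (trans (sym (O-β₁′ y)) p)
    ... | inj₂ q = inj₂ (O₂≥n y q)
    ... | inj₁ q with T₁.O-sound y q
    ...   | inj₁ r = inj₁ r
    ...   | inj₂ le = inj₂ (≤-trans n≤m le)

    O-sound-check : ∀ y → O check y ≡ true → (∃ λ x → O α x ≡ true × ρ x ≡ y) ⊎ (n ≤ y)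
    O-sound-check y p = [ O-sound y , inj₂ ∘ O₂≥n y ∘ O-γ⁻ y ] (∨-true⁻ (O β₁′ y) _ p)

    O-check : ∀ z → O β₁′ z ≡ O check z
    O-check z = ⇔true⇒≡ (∨-trueˡ _) λ p →
      [ (λ q → q) , (λ q → O-β₁′⁺ z (∨-trueʳ (O β₁ z) (O-γ⁻ z q))) ] (∨-true⁻ (O β₁′ z) _ p)

    I-β₁′⁻ : ∀ z → I β₁′ z ≡ true → I β₁ z ≡ true
    I-β₁′⁻ z p = [ (λ q → q) , (λ { (q , _) → ⊥-elim (true≢false q (sources-zeros z)) }) ] (I-thenAssign⁻ β₁ zeros z p)

    I-γ⁻ : ∀ z → I γ z ≡ true → I β₂ z ≡ true ⊎ (testVars ts z ≡ true × O β₂ z ≡ false)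
    I-γ⁻ z p with I-thenAssign⁻ (thenTest β₂ ts) zeros z p
    ... | inj₂ (q , _) = ⊥-elim (true≢false q (sources-zeros z))
    ... | inj₁ q = I-thenTest⁻ β₂ ts z q

    io-disjoint₁′ : IODisjoint β₁′
    io-disjoint₁′ = io-disjoint-thenAssign β₁ zeros T₁.io-disjoint
      (λ z p → ¬true⇒false λ q → let (w , iw , e) = T₁.I-sound z q in
         <⇒≱ (σ< w (∨-trueˡ _ (I⊆vars a w iw))) (subst (n ≤_) (sym e) (O₂≥n z (trans (sym (targets-zeros z)) p))))
      (λ z _ → sources-zeros z)

    io-disjoint-γ : IODisjoint γ
    io-disjoint-γ = io-disjoint-thenAssign (thenTest β₂ ts) zeros (io-disjoint-thenTest β₂ ts T₂.io-disjoint)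
      (λ z p → ¬true⇒false λ q → [ (λ i → true≢false (trans (sym (targets-zeros z)) p) (root-io-disjoint β₂ T₂.io-disjoint z i))
                                  , (λ { (_ , o) → true≢false (trans (sym (targets-zeros z)) p) o }) ] (I-thenTest⁻ β₂ ts z q))
      (λ z _ → sources-zeros z)

    I-sound-tests : ∀ z → testVars ts z ≡ true → O β₂ z ≡ false → O β₁′ z ≡ false →
      ∃ λ w → I α w ≡ true × σ w ≡ z
    I-sound-tests z tv ¬z₂ ¬z₁′
      with ∨-true⁻ (testVars (tests (n +_) after (outputs b)) z) _
             (trans (sym (testVars-++ (tests (n +_) after (outputs b)) (tests ρ σ (missing b a)) z)) tv)
    ... | inj₁ t₁ with testVars-tests⁻ (n +_) after (outputs b) z t₁
    ...   | x , mb , inj₁ e = ⊥-elim (true≢false (subst (λ u → O β₂ u ≡ true) e (T₂.O-complete x (trans (O≡elemᵇ-outputs b x) mb))) ¬z₂)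
    ...   | x , mb , inj₂ e with bool-cases (O a x)
    ...     | inj₁ xa  = ⊥-elim (true≢false (O-β₁′⁺ z (∨-trueˡ _ (subst (λ u → O β₁ u ≡ true) (trans (sym (if-true xa)) e) (T₁.O-complete x xa)))) ¬z₁′)
    ...     | inj₂ ¬xa = x , ∨-trueʳ (I a x) (∨-trueʳ (I b x) (xor-trueʳ ¬xa (trans (O≡elemᵇ-outputs b x) mb))) , trans (sym (if-false ¬xa)) e
    I-sound-tests z tv ¬z₂ ¬z₁′ | inj₂ t₂ with testVars-tests⁻ ρ σ (missing b a) z t₂
    ... | x , mx , inj₁ e = ⊥-elim (true≢false (O-β₁′⁺ z (∨-trueˡ _ (subst (λ u → O β₁ u ≡ true) e
                                      (T₁.O-complete x (proj₁ (elemᵇ-missing⁻ b a x mx)))))) ¬z₁′)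
    ... | x , mx , inj₂ e = let (xa , ¬xb) = elemᵇ-missing⁻ b a x mx in
      x , ∨-trueʳ (I a x) (∨-trueʳ (I b x) (xor-trueˡ xa ¬xb)) , e

    I-sound-check : ∀ z → I check z ≡ true → ∃ λ w → I α w ≡ true × σ w ≡ z
    I-sound-check z p with ∨-true⁻ (I β₁′ z) _ p
    ... | inj₁ q = let (w , iw , e) = T₁.I-sound z (I-β₁′⁻ z q) in w , ∨-trueˡ _ iw , e
    ... | inj₂ q with ∧-true⁻ _ _ q
    ...   | (iγ , ¬z₁′) with I-γ⁻ z iγ
    ...     | inj₁ i₂ = let (w , iw , e) = T₂.I-sound z i₂ in w , ∨-trueʳ (I a w) (∨-trueˡ _ iw) , e
    ...     | inj₂ (tv , ¬z₂) = I-sound-tests z tv ¬z₂ (not-true⁻ _ ¬z₁′)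

    I-sound : ∀ z → I β z ≡ true → ∃ λ w → I α w ≡ true × σ w ≡ z
    I-sound z p with ∨-true⁻ (I β₁′ z) _ p
    ... | inj₁ q = let (w , iw , e) = T₁.I-sound z (I-β₁′⁻ z q) in w , ∨-trueˡ _ iw , e
    ... | inj₂ q with ∨-true⁻ (I check z) _ q
    ...   | inj₁ r = I-sound-check z r
    ...   | inj₂ r = ⊥-elim (true≢false r (xor-≡⇒false (O-check z)))

    I-via-γ : ∀ w → vars α w ≡ true → I γ (σ w) ≡ true → I β (σ w) ≡ true
    I-via-γ w vw p = ∨-trueʳ (I β₁′ (σ w)) (∨-trueˡ _ (∨-trueʳ (I β₁′ (σ w)) (∧-true p (not-true (O₁′-σ w vw)))))

    I-via-tests : ∀ w → vars α w ≡ true → testVars ts (σ w) ≡ true → I β (σ w) ≡ true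
    I-via-tests w vw tv = I-via-γ w vw (I-thenAssign⁺ˡ (thenTest β₂ ts) zeros (σ w)
      (I-thenTest⁺ʳ β₂ ts (σ w) tv (O₂<n (σ w) (σ< w vw))))

    I-complete : ∀ w → I α w ≡ true → I β (σ w) ≡ true
    I-complete w p with ∨-true⁻ (I a w) _ p
    ... | inj₁ q = ∨-trueˡ _ (I-thenAssign⁺ˡ β₁ zeros (σ w) (T₁.I-complete w q))
    ... | inj₂ q with ∨-true⁻ (I b w) _ q
    ...   | inj₁ r = I-via-γ w vw (I-thenAssign⁺ˡ (thenTest β₂ ts) zeros (σ w) (I-thenTest⁺ˡ β₂ ts (σ w) (T₂.I-complete w r)))
      where
      vw : vars α w ≡ true
      vw = I⊆vars α w p
    ...   | inj₂ r with xor-true⁻ (O a w) (O b w) r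
    ...     | inj₁ (wa , ¬wb) = I-via-tests w (I⊆vars α w p)
      (trans (testVars-++ (tests (n +_) after (outputs b)) (tests ρ σ (missing b a)) (σ w))
             (∨-trueʳ (testVars (tests (n +_) after (outputs b)) (σ w))
                      (testVars-testsʳ⁺ ρ σ (missing b a) w (elemᵇ-missing⁺ b a w wa ¬wb))))
    ...     | inj₂ (¬wa , wb) = I-via-tests w (I⊆vars α w p)
      (trans (testVars-++ (tests (n +_) after (outputs b)) (tests ρ σ (missing b a)) (σ w))
             (∨-trueˡ _ (subst (λ u → testVars (tests (n +_) after (outputs b)) u ≡ true) (if-false ¬wa)
                          (testVars-testsʳ⁺ (n +_) after (outputs b) w (trans (sym (O≡elemᵇ-outputs b w)) wb)))))

    after<n : ∀ x → vars α x ≡ true → after x < n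
    after<n x vx with bool-cases (O a x)
    ... | inj₁ xa  rewrite if-true  {x = ρ x} {σ x} xa  = ρ< x xa
    ... | inj₂ ¬xa rewrite if-false {x = ρ x} {σ x} ¬xa = σ< x vx

    module _ (D : Instance S) (ν₁ μ₁ : Valuation) (hv : Agree (vars α) σ ν₁ μ₁) where

      ν-after : Valuation → Valuation
      ν-after μ z = if O a z then μ (ρ z) else ν₁ z

      ν-after-cong : ∀ {μ μ′} → μ ≐ μ′ → ν-after μ ≐ ν-after μ′
      ν-after-cong μ≐μ′ z with O a z
      ... | true  = μ≐μ′ (ρ z)
      ... | false = refl

      agree-β₁′ : ∀ μ → ⟦ β₁′ ⟧ D μ₁ μ → Agree (vars α) σ ν₁ μ
      agree-β₁′ μ h z p = trans (hv z p) (⟦⟧-frame β₁′ D μ₁ μ h (σ z) (O₁′-σ z p))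

      agree-b : ∀ μ → ⟦ β₁′ ⟧ D μ₁ μ → Agree (vars b) σ ν₁ μ
      agree-b μ h z p = agree-β₁′ μ h z (∨-trueʳ (vars a z) p)

      ν-after≡after : ∀ μ → ⟦ β₁′ ⟧ D μ₁ μ → ∀ x → vars α x ≡ true → ν-after μ x ≡ μ (after x)
      ν-after≡after μ h x vx with bool-cases (O a x)
      ... | inj₁ xa  = trans (if-true xa) (cong μ (sym (if-true xa)))
      ... | inj₂ ¬xa = trans (if-false ¬xa) (trans (agree-β₁′ μ h x vx) (cong μ (sym (if-false ¬xa))))

      ν-after-agree : ∀ ν₂ μ → ⟦ a ⟧ D ν₁ ν₂ → Agree (O a) ρ ν₂ μ → ν₂ ≐ ν-after μ
      ν-after-agree ν₂ μ h c z with bool-cases (O a z)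
      ... | inj₁ za  = trans (c z za) (sym (if-true za))
      ... | inj₂ ¬za = trans (sym (⟦⟧-frame a D ν₁ ν₂ h z ¬za)) (sym (if-false ¬za))

      ρ∉zeros : ∀ x → O a x ≡ true → targets zeros (ρ x) ≡ false
      ρ∉zeros x xa = trans (targets-zeros (ρ x)) (O₂<n (ρ x) (ρ< x xa))

      -- Started from a state of β₁′, γ ends where it started: β₂ only changes
      -- its own outputs, which β₁′ and γ both set to 0.
      γ-restores : ∀ μ μ₃ → ⟦ β₁′ ⟧ D μ₁ μ → ⟦ β₂ ⟧ D μ μ₃ → run zeros μ₃ ≐ μ
      γ-restores μ μ₃ h g z with bool-cases (O β₂ z) | ⟦thenAssign⟧⁻ β₁ zeros D μ₁ μ h
      ... | inj₁ z₂  | μ₀ , _ , μ≐ = trans (run-zeroAll (outputs β₂) μ₃ z z∈)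
                                           (sym (trans (μ≐ z) (run-zeroAll (outputs β₂) μ₀ z z∈)))
        where
        z∈ : elemᵇ z (outputs β₂) ≡ true
        z∈ = trans (sym (O≡elemᵇ-outputs β₂ z)) z₂
      ... | inj₂ ¬z₂ | _ = trans (run-untouched zeros μ₃ z (trans (targets-zeros z) ¬z₂)) (sym (⟦⟧-frame β₂ D μ μ₃ g z ¬z₂))

      check-complete : ∀ μ → ⟦ β₁′ ⟧ D μ₁ μ → ⟦ b ⟧ D ν₁ (ν-after μ) → ⟦ check ⟧ D μ₁ μ
      check-complete μ h hb with proj₁ (T₂.simulates D ν₁ μ (agree-b μ h)) (ν-after μ) hb
      ... | μ₃ , g₂ , c₂ = μ , h , ⟦⟧-≐ γ D μ (run zeros μ₃) μ hγ (γ-restores μ μ₃ h g₂)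
        where
        frame₂ : ∀ y → y < n → μ y ≡ μ₃ y
        frame₂ y y<n = ⟦⟧-frame β₂ D μ μ₃ g₂ y (O₂<n y y<n)
        pass-b : ∀ x → elemᵇ x (outputs b) ≡ true → μ₃ (n + x) ≡ μ₃ (after x)
        pass-b x m = begin
          μ₃ (n + x)      ≡⟨ c₂ x xb ⟨
          ν-after μ x     ≡⟨ ν-after≡after μ h x vx ⟩
          μ (after x)     ≡⟨ frame₂ (after x) (after<n x vx) ⟩
          μ₃ (after x)    ∎
          where
          open ≡-Reasoning
          xb : O b x ≡ true
          xb = trans (O≡elemᵇ-outputs b x) m
          vx : vars α x ≡ true
          vx = ∨-trueʳ (vars a x) (O⊆vars b x xb)
        pass-a : ∀ x → elemᵇ x (missing b a) ≡ true → μ₃ (ρ x) ≡ μ₃ (σ x)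
        pass-a x m = begin
          μ₃ (ρ x)        ≡⟨ frame₂ (ρ x) (ρ< x xa) ⟨
          μ (ρ x)         ≡⟨ if-true xa ⟨
          ν-after μ x     ≡⟨ ⟦⟧-frame b D ν₁ (ν-after μ) hb x ¬xb ⟨
          ν₁ x            ≡⟨ agree-β₁′ μ h x vx ⟩
          μ (σ x)         ≡⟨ frame₂ (σ x) (σ< x vx) ⟩
          μ₃ (σ x)        ∎
          where
          open ≡-Reasoning
          xa : O a x ≡ true
          xa = proj₁ (elemᵇ-missing⁻ b a x m)
          ¬xb : O b x ≡ false
          ¬xb = proj₂ (elemᵇ-missing⁻ b a x m)
          vx : vars α x ≡ true
          vx = ∨-trueˡ _ (O⊆vars a x xa)
        passes : Passes μ₃ ts
        passes = Passes-++⁺ μ₃ (tests (n +_) after (outputs b)) (tests ρ σ (missing b a))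
          (Passes-tests⁺ μ₃ (n +_) after (outputs b) pass-b) (Passes-tests⁺ μ₃ ρ σ (missing b a) pass-a)
        hγ : ⟦ γ ⟧ D μ (run zeros μ₃)
        hγ = ⟦thenAssign⟧⁺ (thenTest β₂ ts) zeros D μ μ₃ (⟦thenTest⟧⁺ β₂ ts D μ μ₃ g₂ passes)

      check-sound : ∀ μ₂ → ⟦ check ⟧ D μ₁ μ₂ → ⟦ b ⟧ D ν₁ (ν-after μ₂)
      check-sound μ₂ (μ , h , hγ) with ⟦thenAssign⟧⁻ (thenTest β₂ ts) zeros D μ μ₂ hγ
      ... | μ₃ , hT , μ₂≐ with ⟦thenTest⟧⁻ β₂ ts D μ μ₃ hT
      ...   | g₂ , passes with proj₂ (T₂.simulates D ν₁ μ (agree-b μ h)) μ₃ g₂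
      ...     | ν₂ , hb , c₂ = ⟦⟧-≐ b D ν₁ ν₂ (ν-after μ₂) hb λ z →
                  trans (ν₂≐ z) (ν-after-cong (λ y → sym (trans (μ₂≐ y) (γ-restores μ μ₃ h g₂ y))) z)
        where
        frame₂ : ∀ y → y < n → μ y ≡ μ₃ y
        frame₂ y y<n = ⟦⟧-frame β₂ D μ μ₃ g₂ y (O₂<n y y<n)
        pass-b : ∀ x → elemᵇ x (outputs b) ≡ true → μ₃ (n + x) ≡ μ₃ (after x)
        pass-b = Passes-tests⁻ μ₃ (n +_) after (outputs b)
                   (proj₁ (Passes-++⁻ μ₃ (tests (n +_) after (outputs b)) (tests ρ σ (missing b a)) passes))
        pass-a : ∀ x → elemᵇ x (missing b a) ≡ true → μ₃ (ρ x) ≡ μ₃ (σ x)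
        pass-a = Passes-tests⁻ μ₃ ρ σ (missing b a)
                   (proj₂ (Passes-++⁻ μ₃ (tests (n +_) after (outputs b)) (tests ρ σ (missing b a)) passes))
        ν₂≐ : ν₂ ≐ ν-after μ
        ν₂≐ z with bool-cases (O b z) | bool-cases (O a z)
        ... | inj₁ zb | _ = begin
          ν₂ z            ≡⟨ c₂ z zb ⟩
          μ₃ (n + z)      ≡⟨ pass-b z (trans (sym (O≡elemᵇ-outputs b z)) zb) ⟩
          μ₃ (after z)    ≡⟨ frame₂ (after z) (after<n z vz) ⟨
          μ (after z)     ≡⟨ ν-after≡after μ h z vz ⟨
          ν-after μ z     ∎
          where
          open ≡-Reasoning
          vz : vars α z ≡ true
          vz = ∨-trueʳ (vars a z) (O⊆vars b z zb)
        ... | inj₂ ¬zb | inj₁ za = begin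
          ν₂ z            ≡⟨ ⟦⟧-frame b D ν₁ ν₂ hb z ¬zb ⟨
          ν₁ z            ≡⟨ agree-β₁′ μ h z vz ⟩
          μ (σ z)         ≡⟨ frame₂ (σ z) (σ< z vz) ⟩
          μ₃ (σ z)        ≡⟨ pass-a z (elemᵇ-missing⁺ b a z za ¬zb) ⟨
          μ₃ (ρ z)        ≡⟨ frame₂ (ρ z) (ρ< z za) ⟨
          μ (ρ z)         ≡⟨ if-true za ⟨
          ν-after μ z     ∎
          where
          open ≡-Reasoning
          vz : vars α z ≡ true
          vz = ∨-trueˡ _ (O⊆vars a z za)
        ... | inj₂ ¬zb | inj₂ ¬za = trans (sym (⟦⟧-frame b D ν₁ ν₂ hb z ¬zb)) (sym (if-false ¬za))

      forward : Forward D α β (O α) ρ ν₁ μ₁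
      forward ν₂ (h , ¬hb) with proj₁ (T₁.simulates D ν₁ μ₁ (λ z p → hv z (∨-trueˡ _ p))) ν₂ h
      ... | μ , g₁ , c = run zeros μ , (h′ , ¬check) , agree
        where
        h′ : ⟦ β₁′ ⟧ D μ₁ (run zeros μ)
        h′ = ⟦thenAssign⟧⁺ β₁ zeros D μ₁ μ g₁
        agree : Agree (O a) ρ ν₂ (run zeros μ)
        agree x xa = trans (c x xa) (sym (run-untouched zeros μ (ρ x) (ρ∉zeros x xa)))
        ¬check : ¬ ⟦ check ⟧ D μ₁ (run zeros μ)
        ¬check hc = ¬hb (⟦⟧-≐ b D ν₁ (ν-after (run zeros μ)) ν₂ (check-sound _ hc)
                           (λ z → sym (ν-after-agree ν₂ (run zeros μ) h agree z)))

      backward : Backward D α β (O α) ρ ν₁ μ₁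
      backward μ₂ (h′ , ¬check) with ⟦thenAssign⟧⁻ β₁ zeros D μ₁ μ₂ h′
      ... | μ , g₁ , μ₂≐ with proj₂ (T₁.simulates D ν₁ μ₁ (λ z p → hv z (∨-trueˡ _ p))) μ g₁
      ...   | ν₂ , h , c = ν₂ , (h , λ hb → ¬check (check-complete μ₂ h′ (⟦⟧-≐ b D ν₁ ν₂ _ hb (ν-after-agree ν₂ μ₂ h agree)))) , agree
        where
        agree : Agree (O a) ρ ν₂ μ₂
        agree x xa = trans (c x xa) (trans (sym (run-untouched zeros μ (ρ x) (ρ∉zeros x xa))) (sym (μ₂≐ (ρ x))))

    translation : Translation α σ ρ n β
    translation = record
      { io-disjoint = node-io-disjoint adm β I-sound O-sound , io-disjoint₁′
                    , node-io-disjoint adm check I-sound-check O-sound-check , io-disjoint₁′ , io-disjoint-γ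
      ; I-sound     = I-sound
      ; I-complete  = I-complete
      ; O-complete  = λ x p → O-β₁′⁺ (ρ x) (∨-trueˡ _ (T₁.O-complete x p))
      ; O-sound     = O-sound
      ; simulates   = λ D ν₁ μ₁ hv → forward D ν₁ μ₁ hv , backward D ν₁ μ₁ hv }

module _ {S : Schema} where

  translate : Expr S → (Var → Var) → (Var → Var) → ℕ → Expr S
  translate (atom R xs ys) σ ρ n = atom R (V.map σ xs) (V.map ρ ys)
  translate (eqv x y)      σ ρ n = eqv (σ x) (σ y)
  translate (eqc x c)      σ ρ n = eqc (σ x) c
  translate (asgv x y)     σ ρ n = asgv (ρ x) (σ y)
  translate (asgc x c)     σ ρ n = asgc (ρ x) c
  translate (a ⨾ b)        σ ρ n =
    translate a σ (ρ-left b ρ n) m ⨾ translate b (σ-right a σ (ρ-left b ρ n)) ρ m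
    where
    m : ℕ
    m = n + varBound (a ⨾ b)
  translate (a ∪ₑ b)       σ ρ n = unionTranslation a b σ ρ n (translate a σ ρ n) (translate b σ ρ n)
  translate (a −ₑ b)       σ ρ n = diffTranslation a b σ ρ n (translate a σ ρ m) (translate b σ (n +_) m)
    where
    m : ℕ
    m = n + varBound (a −ₑ b)

  translate-correct : ∀ α σ ρ n → Admissible α σ ρ n → Translation α σ ρ n (translate α σ ρ n)
  translate-correct (atom R xs ys) σ ρ n adm = translation-atom R xs ys σ ρ n adm
  translate-correct (eqv x y)      σ ρ n _   = translation-eqv x y σ ρ n
  translate-correct (eqc x c)      σ ρ n _   = translation-eqc x c σ ρ n
  translate-correct (asgv x y)     σ ρ n adm = translation-asgv x y σ ρ n adm
  translate-correct (asgc x c)     σ ρ n _   = translation-asgc x c σ ρ n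
  translate-correct (a ⨾ b)        σ ρ n adm =
    translation (translate-correct a _ _ _ admissible₁) (translate-correct b _ _ _ admissible₂)
    where open Sequence a b σ ρ n adm
  translate-correct (a ∪ₑ b)       σ ρ n adm =
    translation (translate-correct a _ _ _ admissible₁) (translate-correct b _ _ _ admissible₂)
    where open Union a b σ ρ n adm
  translate-correct (a −ₑ b)       σ ρ n adm =
    translation (translate-correct a _ _ _ admissible₁) (translate-correct b _ _ _ admissible₂)
    where open Difference a b σ ρ n adm

module _ {S : Schema} (α : Expr S) (ρ : Var → Var) (W : List Var) where

  initialBound : ℕ
  initialBound = varBound α + strictBound (L.map ρ (outputs α)) + strictBound W

  initial-admissible : RenamingFor α ρ → Admissible α (λ z → z) ρ initialBound
  initial-admissible (ρ-inj , ρ∉vars) = record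
    { σ<    = λ z p → <-≤-trans (vars<varBound α z p) (≤-trans (m≤m+n _ _) (m≤m+n _ _))
    ; ρ<    = λ x p → <-≤-trans (elemᵇ⇒<strictBound (ρ x) (L.map ρ (outputs α))
                                   (elemᵇ-map⁺ ρ (outputs α) x (trans (sym (O≡elemᵇ-outputs α x)) p)))
                                (≤-trans (m≤n+m _ (varBound α)) (m≤m+n _ _))
    ; ρ-inj = ρ-inj
    ; ρ≢σ   = λ x z ox vz ρx≡z → true≢false (subst (λ u → vars α u ≡ true) (sym ρx≡z) vz) (ρ∉vars x ox) }

  ∈W⇒<initialBound : ∀ y → y ∈ W → y < initialBound
  ∈W⇒<initialBound y y∈W = <-≤-trans (elemᵇ⇒<strictBound y W (∈⇒elemᵇ y W y∈W)) (m≤n+m _ _)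

lemma5p3 : (S : Schema) (α : Expr S) (W : List Var) (ρ : Var → Var) →
  RenamingFor α ρ →
  ∃ λ (β : Expr S) →
    IODisjoint β
    × (∀ z → I β z ≡ I α z)
    × (∀ x → O α x ≡ true → O β (ρ x) ≡ true)
    × (∀ y → O β y ≡ true → ¬ InImage α ρ y → ¬ (y ∈ W))
    × (∀ (D : Instance S) (ν₁ : Valuation) →
        (∀ ν₂ → ⟦ α ⟧ D ν₁ ν₂ →
          ∃ λ ν₂′ → ⟦ β ⟧ D ν₁ ν₂′ × (∀ x → O α x ≡ true → ν₂ x ≡ ν₂′ (ρ x)))
        × (∀ ν₂′ → ⟦ β ⟧ D ν₁ ν₂′ →
          ∃ λ ν₂ → ⟦ α ⟧ D ν₁ ν₂ × (∀ x → O α x ≡ true → ν₂ x ≡ ν₂′ (ρ x))))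
lemma5p3 S α W ρ ren =
  β , T.io-disjoint , I-same , T.O-complete , aux∉W , λ D ν₁ → T.simulates D ν₁ ν₁ (λ z _ → refl)
  where
  n : ℕ
  n = initialBound α ρ W
  β : Expr S
  β = translate α (λ z → z) ρ n
  module T = Translation (translate-correct α (λ z → z) ρ n (initial-admissible α ρ W ren))
  I-same : ∀ z → I β z ≡ I α z
  I-same z = ⇔true⇒≡ (λ p → let (w , iw , w≡z) = T.I-sound z p in subst (λ u → I α u ≡ true) w≡z iw)
                     (T.I-complete z)
  aux∉W : ∀ y → O β y ≡ true → ¬ InImage α ρ y → ¬ (y ∈ W)
  aux∉W y p ¬im y∈W = [ ¬im , <⇒≱ (∈W⇒<initialBound α ρ W y y∈W) ] (T.O-sound y p)
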